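{- Let $G=(V,A)$ be a connected directed graph with node-arc incidence matrix $A$, let $b\in\mathbb{Z}^n$ with $\mathbb{1}^Tb=0$ and $c\in\mathbb{Z}^m$, let $0<\varepsilon<1$, let $\tilde b\in\mathbb{R}^n$, $\tilde c\in\mathbb{R}^m$ with $\|b-\tilde b\|_1\le 2\varepsilon$ and $\|c-\tilde c\|_1\le\varepsilon$, and let $T$ be a spanning tree of $G$. Then: (a) if the unique primal tree solution w.r.t. $T$ for $(G,\tilde b,\tilde c)$ is primal feasible, then the unique primal tree solution w.r.t. $T$ for $(G,b,c)$ is primal feasible; (b) if the dual tree solution w.r.t. $T$ for $(G,\tilde b,\tilde c)$ is dual feasible, then the dual tree solution w.r.t. $T$ for $(G,b,c)$ is dual feasible; (c) if $T$ is optimal for $(G,\tilde b,\tilde c)$ (i.e. its primal and dual tree solutions are both feasible), then $T$ is optimal for $(G,b,c)$.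
   Context: The node-arc incidence matrix has a column per arc $(v,w)$ with $-1$ in row $v$, $+1$ in row $w$, zeros elsewhere. For an instance $(G,b',c')$ (LP pair $\min\{c'^Tx:Ax=b',x\ge0\}$, $\max\{b'^Ty:A^Ty+s=c',s\ge0\}$) and a spanning tree $T$, a primal tree solution is $x\in\mathbb{R}^m$ with $Ax=b'$ and $x_a=0$ for all $a\notin T$; it is primal feasible if $x\ge0$. A dual tree solution is $(y,s)$ with $A^Ty+s=c'$ and $s_a=0$ for all $a\in T$ (unique in $s$); it is dual feasible if $s\ge0$. -}

module Defs where

open import Level using (Level; _⊔_) renaming (suc to lsuc)
open import Data.Nat using (ℕ; zero; suc; _∸_)
open import Data.Integer using (ℤ; +_; -[1+_])
open import Data.Fin using (Fin; zero; suc; _≟_)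
open import Data.Fin.Subset using (Subset; _∈_; _∉_; ⊤) renaming (∣_∣ to card)
open import Data.Product using (_×_; ∃; ∃₂)
open import Relation.Nullary using (¬_; does)
open import Data.Bool using (if_then_else_)
open import Relation.Binary.Core using (Rel)
open import Relation.Binary.Structures using (IsTotalOrder)
open import Relation.Binary.PropositionalEquality using (_≡_)
open import Algebra.Bundles using (CommutativeRing)

-- Ordered fields (ℝ is an instance; the theorem is stated for every
-- ordered field, since agda-stdlib has no real numbers).

record OrderedField (c ℓ₁ ℓ₂ : Level) : Set (lsuc (c ⊔ ℓ₁ ⊔ ℓ₂)) where
  infix 4 _≤_ _<_
  field
    commutativeRing : CommutativeRing c ℓ₁
  open CommutativeRing commutativeRing public
    using (Carrier; _≈_; _+_; _*_; -_; _-_; 0#; 1#)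
  field
    _≤_          : Rel Carrier ℓ₂
    isTotalOrder : IsTotalOrder _≈_ _≤_
    +-monoʳ-≤    : ∀ z {x y} → x ≤ y → x + z ≤ y + z
    *-nonneg     : ∀ {x y} → 0# ≤ x → 0# ≤ y → 0# ≤ x * y
    0≉1          : ¬ (0# ≈ 1#)
    inverse      : ∀ x → ¬ (x ≈ 0#) → ∃ λ y → x * y ≈ 1#
    ∣_∣          : Carrier → Carrier
    abs-nonneg   : ∀ x → 0# ≤ x → ∣ x ∣ ≈ x
    abs-nonpos   : ∀ x → x ≤ 0# → ∣ x ∣ ≈ - x

  _<_ : Rel Carrier (ℓ₁ ⊔ ℓ₂)
  x < y = (x ≤ y) × ¬ (x ≈ y)

  sumF : ∀ {n} → (Fin n → Carrier) → Carrier
  sumF {zero}  f = 0#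
  sumF {suc n} f = f zero + sumF (λ i → f (suc i))

  dist₁ : ∀ {n} → (Fin n → Carrier) → (Fin n → Carrier) → Carrier
  dist₁ u v = sumF (λ i → ∣ u i - v i ∣)

  fromℕ : ℕ → Carrier
  fromℕ zero    = 0#
  fromℕ (suc k) = 1# + fromℕ k

  fromℤ : ℤ → Carrier
  fromℤ (+ k)      = fromℕ k
  fromℤ -[1+ k ]   = - fromℕ (suc k)

sumℤ : ∀ {n} → (Fin n → ℤ) → ℤ
sumℤ {zero}  f = + 0
sumℤ {suc n} f = f zero Data.Integer.+ sumℤ (λ i → f (suc i))

record Digraph : Set where
  field
    n m  : ℕ
    tail : Fin m → Fin n
    head : Fin m → Fin n

module _ (G : Digraph) where
  open Digraph G

  data Walk (S : Subset m) : Fin n → Fin n → Set where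
    stay : ∀ {v} → Walk S v v
    fwd  : ∀ {a w} → a ∈ S → Walk S (head a) w → Walk S (tail a) w
    bwd  : ∀ {a w} → a ∈ S → Walk S (tail a) w → Walk S (head a) w

  Connected : Set
  Connected = ∀ v w → Walk ⊤ v w

  SpanningTree : Subset m → Set
  SpanningTree T = (∀ v w → Walk T v w) × card T ≡ n ∸ 1

  module _ {c ℓ₁ ℓ₂} (F : OrderedField c ℓ₁ ℓ₂) where
    open OrderedField F

    inc : Fin n → Fin m → Carrier
    inc v a = (if does (v ≟ head a) then 1# else 0#)
            - (if does (v ≟ tail a) then 1# else 0#)

    PrimalTreeSol : Subset m → (Fin n → Carrier) → (Fin m → Carrier) → Set ℓ₁
    PrimalTreeSol T b′ x =
      (∀ v → sumF (λ a → inc v a * x a) ≈ b′ v) × (∀ a → a ∉ T → x a ≈ 0#)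

    PrimalFeasible : Subset m → (Fin n → Carrier) → Set (c ⊔ ℓ₁ ⊔ ℓ₂)
    PrimalFeasible T b′ = ∃ λ x → PrimalTreeSol T b′ x × (∀ a → 0# ≤ x a)

    DualTreeSol : Subset m → (Fin m → Carrier) → (Fin n → Carrier) → (Fin m → Carrier) → Set ℓ₁
    DualTreeSol T c′ y s =
      (∀ a → sumF (λ v → inc v a * y v) + s a ≈ c′ a) × (∀ a → a ∈ T → s a ≈ 0#)

    DualFeasible : Subset m → (Fin m → Carrier) → Set (c ⊔ ℓ₁ ⊔ ℓ₂)
    DualFeasible T c′ = ∃₂ λ y s → DualTreeSol T c′ y s × (∀ a → 0# ≤ s a)

    Optimal : Subset m → (Fin n → Carrier) → (Fin m → Carrier) → Set (c ⊔ ℓ₁ ⊔ ℓ₂)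
    Optimal T b′ c′ = PrimalFeasible T b′ × DualFeasible T c′

-- Both parts are proved by peeling leaves off the spanning tree T.
-- Primal: conservation at a leaf v with tree arc e forces x_e = ±b_v, an integer. The residual
-- r = b − A x̃ sums to zero and ‖r‖₁ ≤ 2ε, so |x_e − x̃_e| = |r_v| ≤ ε < 1, and x̃_e ≥ 0 forces
-- x_e ≥ 0. Deleting v and e and moving r_v onto the other end of e does not increase ‖r‖₁, so the
-- argument repeats on the smaller tree.
-- Dual: the integral tree potential y of c and the potential ỹ of c̃ satisfy
-- |(y − ỹ)_w − (y − ỹ)_u| ≤ Σ_{a ∈ T} |c_a − c̃_a|, again by peeling leaves. Hence on a non-tree arc
-- the integer s_a lies within ‖c − c̃‖₁ ≤ ε < 1 of s̃_a ≥ 0, so it is nonnegative.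

module Submission where

open import Defs
open import Level using (Level; _⊔_)
open import Data.Nat as ℕ using (ℕ; zero; suc; _∸_)
import Data.Nat.Properties as ℕP
open import Data.Integer as ℤ using (ℤ; +_; -[1+_])
import Data.Integer.Properties as ℤP
open import Data.Sign as Sign using (Sign)
open import Data.Bool using (Bool; true; false; if_then_else_; _∧_)
open import Data.Fin using (Fin; zero; suc; _≟_)
open import Data.Fin.Subset using (Subset; _∈_; _∉_) renaming (∣_∣ to card)
open import Data.Vec using ([]; _∷_; lookup)
open import Data.Vec.Properties using ([]=⇒lookup; lookup⇒[]=)
open import Data.Product using (_×_; _,_; ∃; proj₁; proj₂)
open import Data.Sum using (_⊎_; inj₁; inj₂)
open import Data.Empty using (⊥-elim)
open import Data.Maybe using (Maybe; just; nothing)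
open import Relation.Nullary using (¬_; yes; no; does)
open import Relation.Binary.PropositionalEquality as ≡ using (_≡_; _≢_; refl)
open import Relation.Binary.Bundles using (Poset)
open import Relation.Binary.Structures using (IsTotalOrder)
open import Algebra.Bundles using (CommutativeRing)
import Algebra.Properties.Ring as RingProperties
import Algebra.Properties.CommutativeSemigroup as CommutativeSemigroupProperties
import Algebra.Solver.Ring.AlmostCommutativeRing as ACR
import Algebra.Solver.Ring
import Relation.Binary.Reasoning.Setoid as SetoidReasoning
import Relation.Binary.Reasoning.PartialOrder as PosetReasoning

module OrderedFieldProperties {c ℓ₁ ℓ₂ : Level} (F : OrderedField c ℓ₁ ℓ₂) where

  open OrderedField F public
  open CommutativeRing commutativeRing public
    using (setoid; ring; +-cong; *-cong; -‿cong; +-comm; +-assoc; *-assoc;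
           +-identityˡ; +-identityʳ; *-identityˡ; zeroˡ; zeroʳ; -‿inverseʳ; distribˡ; distribʳ)
    renaming (refl to ≈-refl; sym to ≈-sym; trans to ≈-trans; reflexive to ≈-reflexive)
  open IsTotalOrder isTotalOrder public
    using (total; antisym; reflexive; ≤-respˡ-≈; ≤-respʳ-≈; isPartialOrder)
    renaming (refl to ≤-refl; trans to ≤-trans)
  open RingProperties ring public
    using (x[y-z]≈xy-xz; [y-z]x≈yx-zx; -1*x≈-x; -‿involutive; -‿+-comm; -‿distribˡ-*; -‿distribʳ-*; -0#≈0#)
  open CommutativeSemigroupProperties (CommutativeRing.+-commutativeSemigroup commutativeRing) public
    using (interchange; x∙yz≈y∙xz)

  poset : Poset c ℓ₁ ℓ₂
  poset = record { isPartialOrder = isPartialOrder }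

  module ≈-Reasoning = SetoidReasoning setoid
  module ≤-Reasoning = PosetReasoning poset

  fromℕ-+ : ∀ i j → fromℕ (i ℕ.+ j) ≈ fromℕ i + fromℕ j
  fromℕ-+ zero    j = ≈-sym (+-identityˡ _)
  fromℕ-+ (suc i) j = ≈-trans (+-cong ≈-refl (fromℕ-+ i j)) (≈-sym (+-assoc _ _ _))

  fromℕ-* : ∀ i j → fromℕ (i ℕ.* j) ≈ fromℕ i * fromℕ j
  fromℕ-* zero    j = ≈-sym (zeroˡ _)
  fromℕ-* (suc i) j = begin
    fromℕ (j ℕ.+ i ℕ.* j)       ≈⟨ fromℕ-+ j (i ℕ.* j) ⟩
    fromℕ j + fromℕ (i ℕ.* j)   ≈⟨ +-cong (≈-sym (*-identityˡ _)) (fromℕ-* i j) ⟩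
    1# * fromℕ j + fromℕ i * fromℕ j ≈⟨ distribʳ _ _ _ ⟨
    fromℕ (suc i) * fromℕ j     ∎
    where open ≈-Reasoning

  x+y-[x+z]≈y-z : ∀ x y z → (x + y) - (x + z) ≈ y - z
  x+y-[x+z]≈y-z x y z = begin
    (x + y) - (x + z)     ≈⟨ +-cong ≈-refl (-‿+-comm x z) ⟨
    (x + y) + (- x + - z) ≈⟨ interchange x y (- x) (- z) ⟩
    (x - x) + (y - z)     ≈⟨ +-cong (-‿inverseʳ x) ≈-refl ⟩
    0# + (y - z)          ≈⟨ +-identityˡ _ ⟩
    y - z                 ∎
    where open ≈-Reasoning

  fromℤ-⊖ : ∀ i j → fromℤ (i ℤ.⊖ j) ≈ fromℕ i - fromℕ j
  fromℤ-⊖ zero    zero    = ≈-sym (-‿inverseʳ 0#)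
  fromℤ-⊖ (suc i) zero    = ≈-trans (≈-sym (+-identityʳ _)) (+-cong ≈-refl (≈-sym -0#≈0#))
  fromℤ-⊖ zero    (suc j) = ≈-sym (+-identityˡ _)
  fromℤ-⊖ (suc i) (suc j) = begin
    fromℤ (suc i ℤ.⊖ suc j)       ≡⟨ ≡.cong fromℤ (ℤP.[1+m]⊖[1+n]≡m⊖n i j) ⟩
    fromℤ (i ℤ.⊖ j)               ≈⟨ fromℤ-⊖ i j ⟩
    fromℕ i - fromℕ j             ≈⟨ x+y-[x+z]≈y-z 1# (fromℕ i) (fromℕ j) ⟨
    fromℕ (suc i) - fromℕ (suc j) ∎
    where open ≈-Reasoning

  fromℤ-+ : ∀ i j → fromℤ (i ℤ.+ j) ≈ fromℤ i + fromℤ j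
  fromℤ-+ -[1+ i ] -[1+ j ] = begin
    - (1# + fromℕ (suc (i ℕ.+ j)))       ≈⟨ -‿cong (+-cong ≈-refl (+-cong ≈-refl (fromℕ-+ i j))) ⟩
    - (1# + (1# + (fromℕ i + fromℕ j)))  ≈⟨ -‿cong (+-cong ≈-refl (≈-sym (+-assoc 1# _ _))) ⟩
    - (1# + ((1# + fromℕ i) + fromℕ j))  ≈⟨ -‿cong (x∙yz≈y∙xz 1# _ _) ⟩
    - ((1# + fromℕ i) + (1# + fromℕ j))  ≈⟨ -‿+-comm _ _ ⟨
    fromℤ -[1+ i ] + fromℤ -[1+ j ]      ∎
    where open ≈-Reasoning
  fromℤ-+ -[1+ i ] (+ j)    = ≈-trans (fromℤ-⊖ j (suc i)) (+-comm _ _)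
  fromℤ-+ (+ i)    -[1+ j ] = fromℤ-⊖ i (suc j)
  fromℤ-+ (+ i)    (+ j)    = fromℕ-+ i j

  fromℤ-neg : ∀ i → fromℤ (ℤ.- i) ≈ - fromℤ i
  fromℤ-neg -[1+ i ]  = ≈-sym (-‿involutive _)
  fromℤ-neg (+ zero)  = ≈-sym -0#≈0#
  fromℤ-neg (+ suc i) = ≈-refl

  private
    signed : Sign → Carrier → Carrier
    signed Sign.+ x = x
    signed Sign.- x = - x

    signed-cong : ∀ s {x y} → x ≈ y → signed s x ≈ signed s y
    signed-cong Sign.+ e = e
    signed-cong Sign.- e = -‿cong e

    fromℤ-◃ : ∀ s i → fromℤ (s ℤ.◃ i) ≈ signed s (fromℕ i)
    fromℤ-◃ Sign.- zero    = ≈-sym -0#≈0#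
    fromℤ-◃ Sign.- (suc i) = ≈-refl
    fromℤ-◃ Sign.+ zero    = ≈-refl
    fromℤ-◃ Sign.+ (suc i) = ≈-refl

    fromℤ-signed : ∀ i → fromℤ i ≈ signed (ℤ.sign i) (fromℕ ℤ.∣ i ∣)
    fromℤ-signed -[1+ i ] = ≈-refl
    fromℤ-signed (+ i)    = ≈-refl

    signed-* : ∀ s t x y → signed (s Sign.* t) (x * y) ≈ signed s x * signed t y
    signed-* Sign.+ Sign.+ x y = ≈-refl
    signed-* Sign.+ Sign.- x y = -‿distribʳ-* x y
    signed-* Sign.- Sign.+ x y = -‿distribˡ-* x y
    signed-* Sign.- Sign.- x y = begin
      x * y         ≈⟨ -‿involutive _ ⟨
      - - (x * y)   ≈⟨ -‿cong (-‿distribʳ-* x y) ⟩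
      - (x * - y)   ≈⟨ -‿distribˡ-* x (- y) ⟩
      - x * - y     ∎
      where open ≈-Reasoning

  fromℤ-* : ∀ i j → fromℤ (i ℤ.* j) ≈ fromℤ i * fromℤ j
  fromℤ-* i j = begin
    fromℤ (i ℤ.* j)                         ≈⟨ fromℤ-◃ (s Sign.* t) (∣i∣ ℕ.* ∣j∣) ⟩
    signed (s Sign.* t) (fromℕ (∣i∣ ℕ.* ∣j∣)) ≈⟨ signed-cong (s Sign.* t) (fromℕ-* ∣i∣ ∣j∣) ⟩
    signed (s Sign.* t) (fromℕ ∣i∣ * fromℕ ∣j∣) ≈⟨ signed-* s t _ _ ⟩
    signed s (fromℕ ∣i∣) * signed t (fromℕ ∣j∣) ≈⟨ *-cong (fromℤ-signed i) (fromℤ-signed j) ⟨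
    fromℤ i * fromℤ j                       ∎
    where
    open ≈-Reasoning
    s = ℤ.sign i
    t = ℤ.sign j
    ∣i∣ = ℤ.∣ i ∣
    ∣j∣ = ℤ.∣ j ∣

  fromℤ-morphism : ℤ.+-*-rawRing ACR.-Raw-AlmostCommutative⟶ ACR.fromCommutativeRing commutativeRing
  fromℤ-morphism = record
    { ⟦_⟧    = fromℤ
    ; +-homo = fromℤ-+
    ; *-homo = fromℤ-*
    ; -‿homo = fromℤ-neg
    ; 0-homo = ≈-refl
    ; 1-homo = +-identityʳ 1#
    }

  private
    fromℤ-≟ : ∀ i j → Maybe (fromℤ i ≈ fromℤ j)
    fromℤ-≟ i j with i ℤ.≟ j
    ... | yes refl = just ≈-refl
    ... | no _     = nothing

  open Algebra.Solver.Ring ℤ.+-*-rawRing (ACR.fromCommutativeRing commutativeRing) fromℤ-morphism fromℤ-≟ public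
    using (solve; _:=_; _:+_; _:*_; :-_; _:-_)

  +-monoˡ-≤ : ∀ z {x y} → x ≤ y → z + x ≤ z + y
  +-monoˡ-≤ z x≤y = ≤-respʳ-≈ (+-comm _ z) (≤-respˡ-≈ (+-comm _ z) (+-monoʳ-≤ z x≤y))

  +-mono-≤ : ∀ {x y u v} → x ≤ y → u ≤ v → x + u ≤ y + v
  +-mono-≤ {y = y} {u} x≤y u≤v = ≤-trans (+-monoʳ-≤ u x≤y) (+-monoˡ-≤ y u≤v)

  -‿antitone : ∀ {x y} → x ≤ y → - y ≤ - x
  -‿antitone {x} {y} x≤y = ≤-respˡ-≈ (left x y) (≤-respʳ-≈ (right x y) (+-monoʳ-≤ (- x - y) x≤y))
    where
    left : ∀ x y → x + (- x - y) ≈ - y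
    right : ∀ x y → y + (- x - y) ≈ - x
    left = solve 2 (λ x y → x :+ (:- x :- y) := :- y) ≈-refl
    right = solve 2 (λ x y → y :+ (:- x :- y) := :- x) ≈-refl

  0≤x⇒-x≤0 : ∀ {x} → 0# ≤ x → - x ≤ 0#
  0≤x⇒-x≤0 0≤x = ≤-respʳ-≈ -0#≈0# (-‿antitone 0≤x)

  x≤0⇒0≤-x : ∀ {x} → x ≤ 0# → 0# ≤ - x
  x≤0⇒0≤-x x≤0 = ≤-respˡ-≈ -0#≈0# (-‿antitone x≤0)

  -1*-1≈1 : - 1# * - 1# ≈ 1#
  -1*-1≈1 = ≈-trans (-1*x≈-x (- 1#)) (-‿involutive 1#)

  0≤1 : 0# ≤ 1#
  0≤1 with total 0# 1#
  ... | inj₁ 0≤1 = 0≤1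
  ... | inj₂ 1≤0 = ⊥-elim (0≉1 (antisym (≤-respʳ-≈ -1*-1≈1 (*-nonneg 0≤-1 0≤-1)) 1≤0))
    where
    0≤-1 : 0# ≤ - 1#
    0≤-1 = x≤0⇒0≤-x 1≤0

  fromℕ-nonneg : ∀ i → 0# ≤ fromℕ i
  fromℕ-nonneg zero    = ≤-refl
  fromℕ-nonneg (suc i) = ≤-respˡ-≈ (+-identityʳ 0#) (+-mono-≤ 0≤1 (fromℕ-nonneg i))

  x+x≤y+y⇒x≤y : ∀ {x y} → x + x ≤ y + y → x ≤ y
  x+x≤y+y⇒x≤y {x} {y} x+x≤y+y with total x y
  ... | inj₁ x≤y = x≤y
  ... | inj₂ y≤x = reflexive (antisym-step (antisym (≤-trans (+-monoʳ-≤ x y≤x) x+x≤y+y) (+-monoˡ-≤ y y≤x)))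
    where
    antisym-step : y + x ≈ y + y → x ≈ y
    antisym-step e = begin
      x            ≈⟨ solve 2 (λ x y → x := :- y :+ (y :+ x)) ≈-refl x y ⟩
      - y + (y + x) ≈⟨ +-cong ≈-refl e ⟩
      - y + (y + y) ≈⟨ solve 1 (λ y → :- y :+ (y :+ y) := y) ≈-refl y ⟩
      y            ∎
      where open ≈-Reasoning

  ∣x∣≈x∨∣x∣≈-x : ∀ x → (0# ≤ x × ∣ x ∣ ≈ x) ⊎ (x ≤ 0# × ∣ x ∣ ≈ - x)
  ∣x∣≈x∨∣x∣≈-x x with total 0# x
  ... | inj₁ 0≤x = inj₁ (0≤x , abs-nonneg x 0≤x)
  ... | inj₂ x≤0 = inj₂ (x≤0 , abs-nonpos x x≤0)

  0≤∣x∣ : ∀ x → 0# ≤ ∣ x ∣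
  0≤∣x∣ x with ∣x∣≈x∨∣x∣≈-x x
  ... | inj₁ (0≤x , e) = ≤-respʳ-≈ (≈-sym e) 0≤x
  ... | inj₂ (x≤0 , e) = ≤-respʳ-≈ (≈-sym e) (x≤0⇒0≤-x x≤0)

  x≤∣x∣ : ∀ x → x ≤ ∣ x ∣
  x≤∣x∣ x with ∣x∣≈x∨∣x∣≈-x x
  ... | inj₁ (_ , e)   = reflexive (≈-sym e)
  ... | inj₂ (x≤0 , _) = ≤-trans x≤0 (0≤∣x∣ x)

  -x≤∣x∣ : ∀ x → - x ≤ ∣ x ∣
  -x≤∣x∣ x with ∣x∣≈x∨∣x∣≈-x x
  ... | inj₁ (0≤x , _) = ≤-trans (0≤x⇒-x≤0 0≤x) (0≤∣x∣ x)
  ... | inj₂ (_ , e)   = reflexive (≈-sym e)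

  ∣x∣≤y : ∀ {x y} → x ≤ y → - x ≤ y → ∣ x ∣ ≤ y
  ∣x∣≤y {x} x≤y -x≤y with ∣x∣≈x∨∣x∣≈-x x
  ... | inj₁ (_ , e) = ≤-respˡ-≈ (≈-sym e) x≤y
  ... | inj₂ (_ , e) = ≤-respˡ-≈ (≈-sym e) -x≤y

  ∣-∣-cong : ∀ {x y} → x ≈ y → ∣ x ∣ ≈ ∣ y ∣
  ∣-∣-cong {x} {y} x≈y = antisym (bound x≈y) (bound (≈-sym x≈y))
    where
    bound : ∀ {x y} → x ≈ y → ∣ x ∣ ≤ ∣ y ∣
    bound {x} {y} x≈y = ∣x∣≤y (≤-respˡ-≈ (≈-sym x≈y) (x≤∣x∣ y)) (≤-respˡ-≈ (-‿cong (≈-sym x≈y)) (-x≤∣x∣ y))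

  ∣-x∣≈∣x∣ : ∀ x → ∣ - x ∣ ≈ ∣ x ∣
  ∣-x∣≈∣x∣ x = antisym (∣x∣≤y (-x≤∣x∣ x) (≤-respˡ-≈ (≈-sym (-‿involutive x)) (x≤∣x∣ x)))
                       (∣x∣≤y (≤-respˡ-≈ (-‿involutive x) (-x≤∣x∣ (- x))) (x≤∣x∣ (- x)))

  x+y≈0⇒y≈-x : ∀ {x y} → x + y ≈ 0# → y ≈ - x
  x+y≈0⇒y≈-x {x} {y} x+y≈0 = begin
    y             ≈⟨ solve 2 (λ x y → y := :- x :+ (x :+ y)) ≈-refl x y ⟩
    - x + (x + y) ≈⟨ +-cong ≈-refl x+y≈0 ⟩
    - x + 0#      ≈⟨ +-identityʳ _ ⟩
    - x           ∎
    where open ≈-Reasoning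

  x≈0⇒-x≈0 : ∀ {x} → x ≈ 0# → - x ≈ 0#
  x≈0⇒-x≈0 x≈0 = ≈-trans (-‿cong x≈0) -0#≈0#

  x≈0⇒y≈0⇒x-y≈0 : ∀ {x y} → x ≈ 0# → y ≈ 0# → x - y ≈ 0#
  x≈0⇒y≈0⇒x-y≈0 x≈0 y≈0 = ≈-trans (+-cong x≈0 (x≈0⇒-x≈0 y≈0)) (+-identityʳ 0#)

  ∣0∣≈0 : ∣ 0# ∣ ≈ 0#
  ∣0∣≈0 = abs-nonneg 0# ≤-refl

  ∣x+y∣≤∣x∣+∣y∣ : ∀ x y → ∣ x + y ∣ ≤ ∣ x ∣ + ∣ y ∣
  ∣x+y∣≤∣x∣+∣y∣ x y = ∣x∣≤y (+-mono-≤ (x≤∣x∣ x) (x≤∣x∣ y))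
                           (≤-respˡ-≈ (-‿+-comm x y) (+-mono-≤ (-x≤∣x∣ x) (-x≤∣x∣ y)))

  IsSign : Carrier → Set ℓ₁
  IsSign σ = σ ≈ 1# ⊎ σ ≈ - 1#

  sign*sign≈1 : ∀ {σ} → IsSign σ → σ * σ ≈ 1#
  sign*sign≈1 (inj₁ σ≈1)  = ≈-trans (*-cong σ≈1 σ≈1) (*-identityˡ 1#)
  sign*sign≈1 (inj₂ σ≈-1) = ≈-trans (*-cong σ≈-1 σ≈-1) -1*-1≈1

  ∣sign*x∣≈∣x∣ : ∀ {σ} → IsSign σ → ∀ x → ∣ σ * x ∣ ≈ ∣ x ∣
  ∣sign*x∣≈∣x∣ (inj₁ σ≈1)  x = ∣-∣-cong (≈-trans (*-cong σ≈1 ≈-refl) (*-identityˡ x))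
  ∣sign*x∣≈∣x∣ (inj₂ σ≈-1) x = ≈-trans (∣-∣-cong (≈-trans (*-cong σ≈-1 ≈-refl) (-1*x≈-x x))) (∣-x∣≈∣x∣ x)

  sign-flip : ∀ {σ x y} → IsSign σ → x ≈ σ * y → y ≈ σ * x
  sign-flip {σ} {x} {y} σ-sign x≈σy = begin
    y             ≈⟨ *-identityˡ y ⟨
    1# * y        ≈⟨ *-cong (sign*sign≈1 σ-sign) ≈-refl ⟨
    σ * σ * y     ≈⟨ *-assoc σ σ y ⟩
    σ * (σ * y)   ≈⟨ *-cong ≈-refl x≈σy ⟨
    σ * x         ∎
    where open ≈-Reasoning

  Integral : Carrier → Set ℓ₁
  Integral x = ∃ λ k → x ≈ fromℤ k

  fromℤ-integral : ∀ k → Integral (fromℤ k)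
  fromℤ-integral k = k , ≈-refl

  integral-+ : ∀ {x y} → Integral x → Integral y → Integral (x + y)
  integral-+ (k , x≈k) (l , y≈l) = k ℤ.+ l , ≈-trans (+-cong x≈k y≈l) (≈-sym (fromℤ-+ k l))

  integral-- : ∀ {x y} → Integral x → Integral y → Integral (x - y)
  integral-- (k , x≈k) (l , y≈l) =
    k ℤ.- l , ≈-trans (+-cong x≈k (-‿cong y≈l)) (≈-sym (≈-trans (fromℤ-+ k (ℤ.- l)) (+-cong ≈-refl (fromℤ-neg l))))

  integral-* : ∀ {x y} → Integral x → Integral y → Integral (x * y)
  integral-* (k , x≈k) (l , y≈l) = k ℤ.* l , ≈-trans (*-cong x≈k y≈l) (≈-sym (fromℤ-* k l))

  integral-near-nonneg : ∀ {z w ε} → Integral z → 0# ≤ w → ∣ z - w ∣ ≤ ε → ε < 1# → 0# ≤ z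
  integral-near-nonneg (+ i , z≈i) _ _ _ = ≤-respʳ-≈ (≈-sym z≈i) (fromℕ-nonneg i)
  integral-near-nonneg {z} {w} {ε} (-[1+ i ] , z≈-[1+i]) 0≤w ∣z-w∣≤ε (ε≤1 , ε≉1) =
    ⊥-elim (ε≉1 (antisym ε≤1 1≤ε))
    where
    1≤ε : 1# ≤ ε
    1≤ε = begin
      1#                          ≈⟨ ≈-trans (+-identityʳ _) (+-identityʳ _) ⟨
      1# + 0# + 0#                ≤⟨ +-mono-≤ (+-monoˡ-≤ 1# (fromℕ-nonneg i)) 0≤w ⟩
      1# + fromℕ i + w            ≈⟨ solve 3 (λ z i w → z :+ i :+ w := :- (:- (z :+ i) :- w)) ≈-refl 1# (fromℕ i) w ⟩
      - (- (1# + fromℕ i) - w)    ≈⟨ -‿cong (+-cong z≈-[1+i] ≈-refl) ⟨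
      - (z - w)                   ≤⟨ -x≤∣x∣ (z - w) ⟩
      ∣ z - w ∣                   ≤⟨ ∣z-w∣≤ε ⟩
      ε                           ∎
      where open ≤-Reasoning

module Counting where

  open import Algebra.Properties.CommutativeMonoid.Sum ℕP.+-0-commutativeMonoid public
    using (sum; sum-cong-≗; ∑-distrib-+; ∑-comm; sum-replicate-zero)

  iverson : Bool → ℕ
  iverson b = if b then 1 else 0

  count : ∀ {k} → (Fin k → Bool) → ℕ
  count P = sum (λ i → iverson (P i))

  remove : ∀ {k} → Fin k → (Fin k → Bool) → Fin k → Bool
  remove x P y = if does (y ≟ x) then false else P y

  remove⁺ : ∀ {k} {x y : Fin k} {P} → y ≢ x → P y ≡ true → remove x P y ≡ true
  remove⁺ {x = x} {y} y≢x Py with y ≟ x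
  ... | yes y≡x = ⊥-elim (y≢x y≡x)
  ... | no _    = Py

  remove⁻ : ∀ {k} {x y : Fin k} {P} → remove x P y ≡ true → y ≢ x × P y ≡ true
  remove⁻ {x = x} {y} r with y ≟ x | r
  ... | yes _   | ()
  ... | no y≢x  | Py = y≢x , Py

  remove-removes : ∀ {k} (x : Fin k) P → remove x P x ≡ false
  remove-removes x P with x ≟ x
  ... | yes _  = refl
  ... | no x≢x = ⊥-elim (x≢x refl)

  remove-false : ∀ {k} {x y : Fin k} {P} → P y ≡ false → remove x P y ≡ false
  remove-false {x = x} {y} Py with y ≟ x
  ... | yes _ = refl
  ... | no _  = Py

  count-remove : ∀ {k} (P : Fin k → Bool) {a} → P a ≡ true → count P ≡ suc (count (remove a P))
  count-remove P {zero}  Pa rewrite Pa = refl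
  count-remove P {suc a} Pa = ≡.trans (≡.cong (iverson (P zero) ℕ.+_) (count-remove (λ i → P (suc i)) Pa))
                                      (ℕP.+-suc _ _)

  count≡0⇒false : ∀ {k} (P : Fin k → Bool) {a} → count P ≡ 0 → P a ≡ false
  count≡0⇒false P {a} count≡0 with P a in Pa
  ... | false = refl
  ... | true  = ⊥-elim (ℕP.1+n≢0 (≡.trans (≡.sym (count-remove P Pa)) count≡0))

  count≡suc⇒∃ : ∀ {k} (P : Fin k → Bool) {j} → count P ≡ suc j → ∃ λ a → P a ≡ true
  count≡suc⇒∃ {suc k} P count≡suc with P zero in P0
  ... | true  = zero , P0
  ... | false = let a , Pa = count≡suc⇒∃ (λ i → P (suc i)) count≡suc in suc a , Pa

  1≤count : ∀ {k} (P : Fin k → Bool) {a} → P a ≡ true → 1 ℕ.≤ count P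
  1≤count P Pa rewrite count-remove P Pa = ℕ.s≤s ℕ.z≤n

  2≤count : ∀ {k} (P : Fin k → Bool) {a b} → P a ≡ true → P b ≡ true → a ≢ b → 2 ℕ.≤ count P
  2≤count P {a} Pa Pb a≢b rewrite count-remove P Pa =
    ℕ.s≤s (1≤count (remove a P) (remove⁺ {P = P} (λ b≡a → a≢b (≡.sym b≡a)) Pb))

  count-all : ∀ k → count {k} (λ _ → true) ≡ k
  count-all zero    = refl
  count-all (suc k) = ≡.cong suc (count-all k)

  count≡1⇒singleton : ∀ {k} (P : Fin k → Bool) → count P ≡ 1 →
                      ∃ λ x → P x ≡ true × (∀ y → P y ≡ true → y ≡ x)
  count≡1⇒singleton P count≡1 with count≡suc⇒∃ P count≡1
  ... | x , Px = x , Px , only-x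
    where
    only-x : ∀ y → P y ≡ true → y ≡ x
    only-x y Py with y ≟ x
    ... | yes y≡x = y≡x
    ... | no y≢x  = ⊥-elim (ℕP.1+n≢0 (≡.trans (≡.sym (count-remove (remove x P) (remove⁺ {P = P} y≢x Py)))
                                              (ℕP.suc-injective (≡.trans (≡.sym (count-remove P Px)) count≡1))))

  sum-iverson-≟ : ∀ {k} (x : Fin k) → sum (λ i → iverson (does (i ≟ x))) ≡ 1
  sum-iverson-≟ {suc k} zero    = ≡.cong suc (sum-replicate-zero k)
  sum-iverson-≟ {suc k} (suc x) = sum-iverson-≟ x

  sum<sum⇒∃< : ∀ {k} (f g : Fin k → ℕ) → sum f ℕ.< sum g → ∃ λ i → f i ℕ.< g i
  sum<sum⇒∃< {suc k} f g Σf<Σg with ℕP.<-≤-connex (f zero) (g zero)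
  ... | inj₁ f0<g0 = zero , f0<g0
  ... | inj₂ g0≤f0 =
    let i , fi<gi = sum<sum⇒∃< (λ i → f (suc i)) (λ i → g (suc i))
                      (ℕP.+-cancelˡ-< (g zero) _ _ (ℕP.≤-<-trans (ℕP.+-monoˡ-≤ _ g0≤f0) Σf<Σg))
    in suc i , fi<gi

module FiniteSums {c ℓ₁ ℓ₂ : Level} (F : OrderedField c ℓ₁ ℓ₂) where

  open OrderedFieldProperties F
  open Counting using (remove)

  δ : ∀ {k} → Fin k → Carrier → Fin k → Carrier
  δ x a i = if does (i ≟ x) then a else 0#

  _[_≔_] : ∀ {k} → (Fin k → Carrier) → Fin k → Carrier → Fin k → Carrier
  (f [ x ≔ a ]) i = if does (i ≟ x) then a else f i

  [≔]-updates : ∀ {k} (f : Fin k → Carrier) x a → (f [ x ≔ a ]) x ≡ a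
  [≔]-updates f x a with x ≟ x
  ... | yes _  = refl
  ... | no x≢x = ⊥-elim (x≢x refl)

  [≔]-minimal : ∀ {k} (f : Fin k → Carrier) {x i} a → i ≢ x → (f [ x ≔ a ]) i ≡ f i
  [≔]-minimal f {x} {i} a i≢x with i ≟ x
  ... | yes i≡x = ⊥-elim (i≢x i≡x)
  ... | no _    = refl

  [≔]-split : ∀ {k} (f : Fin k → Carrier) x a → f x ≈ 0# → ∀ i → (f [ x ≔ a ]) i ≈ f i + δ x a i
  [≔]-split f x a fx≈0 i with i ≟ x
  ... | yes refl = ≈-trans (≈-sym (+-identityˡ a)) (+-cong (≈-sym fx≈0) ≈-refl)
  ... | no _     = ≈-sym (+-identityʳ _)

  [≔0]-split : ∀ {k} (f : Fin k → Carrier) x i → f i ≈ (f [ x ≔ 0# ]) i + δ x (f x) i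
  [≔0]-split f x i with i ≟ x
  ... | yes refl = ≈-sym (+-identityˡ _)
  ... | no _     = ≈-sym (+-identityʳ _)

  δ-≡ : ∀ {k} {x i : Fin k} a → i ≡ x → δ x a i ≈ a
  δ-≡ {x = x} {i} a i≡x with i ≟ x
  ... | yes _   = ≈-refl
  ... | no i≢x  = ⊥-elim (i≢x i≡x)

  δ-≢ : ∀ {k} {x i : Fin k} a → i ≢ x → δ x a i ≈ 0#
  δ-≢ {x = x} {i} a i≢x with i ≟ x
  ... | yes i≡x = ⊥-elim (i≢x i≡x)
  ... | no _    = ≈-refl

  Supported : ∀ {k} → (Fin k → Bool) → (Fin k → Carrier) → Set ℓ₁
  Supported S f = ∀ i → S i ≡ false → f i ≈ 0#

  Nonneg : ∀ {k} → (Fin k → Carrier) → Set ℓ₂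
  Nonneg f = ∀ i → 0# ≤ f i

  sumF-fromℤ : ∀ {k} (f : Fin k → ℤ) → sumF (λ i → fromℤ (f i)) ≈ fromℤ (sumℤ f)
  sumF-fromℤ {zero}  f = ≈-refl
  sumF-fromℤ {suc k} f = ≈-trans (+-cong ≈-refl (sumF-fromℤ (λ i → f (suc i)))) (≈-sym (fromℤ-+ (f zero) _))

  sumF-cong : ∀ {k} {f g : Fin k → Carrier} → (∀ i → f i ≈ g i) → sumF f ≈ sumF g
  sumF-cong {zero}  f≈g = ≈-refl
  sumF-cong {suc k} f≈g = +-cong (f≈g zero) (sumF-cong (λ i → f≈g (suc i)))

  sumF-mono-≤ : ∀ {k} {f g : Fin k → Carrier} → (∀ i → f i ≤ g i) → sumF f ≤ sumF g
  sumF-mono-≤ {zero}  f≤g = ≤-refl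
  sumF-mono-≤ {suc k} f≤g = +-mono-≤ (f≤g zero) (sumF-mono-≤ (λ i → f≤g (suc i)))

  sumF-0 : ∀ k → sumF {k} (λ _ → 0#) ≈ 0#
  sumF-0 zero    = ≈-refl
  sumF-0 (suc k) = ≈-trans (+-identityˡ _) (sumF-0 k)

  sumF-zero : ∀ {k} {f : Fin k → Carrier} → (∀ i → f i ≈ 0#) → sumF f ≈ 0#
  sumF-zero {k} f≈0 = ≈-trans (sumF-cong f≈0) (sumF-0 k)

  sumF-nonneg : ∀ {k} {f : Fin k → Carrier} → Nonneg f → 0# ≤ sumF f
  sumF-nonneg {k} 0≤f = ≤-respˡ-≈ (sumF-0 k) (sumF-mono-≤ 0≤f)

  sumF-+ : ∀ {k} (f g : Fin k → Carrier) → sumF (λ i → f i + g i) ≈ sumF f + sumF g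
  sumF-+ {zero}  f g = ≈-sym (+-identityˡ 0#)
  sumF-+ {suc k} f g = ≈-trans (+-cong ≈-refl (sumF-+ (λ i → f (suc i)) (λ i → g (suc i))))
                               (interchange (f zero) (g zero) _ _)

  sumF-neg : ∀ {k} (f : Fin k → Carrier) → sumF (λ i → - f i) ≈ - sumF f
  sumF-neg {zero}  f = ≈-sym -0#≈0#
  sumF-neg {suc k} f = ≈-trans (+-cong ≈-refl (sumF-neg (λ i → f (suc i)))) (-‿+-comm _ _)

  sumF-- : ∀ {k} (f g : Fin k → Carrier) → sumF (λ i → f i - g i) ≈ sumF f - sumF g
  sumF-- f g = ≈-trans (sumF-+ f (λ i → - g i)) (+-cong ≈-refl (sumF-neg g))

  sumF-swap : ∀ {k l} (f : Fin k → Fin l → Carrier) →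
              sumF (λ i → sumF (λ j → f i j)) ≈ sumF (λ j → sumF (λ i → f i j))
  sumF-swap {zero}  {l} f = ≈-sym (sumF-0 l)
  sumF-swap {suc k} {l} f = ≈-trans (+-cong ≈-refl (sumF-swap (λ i → f (suc i))))
                                    (≈-sym (sumF-+ (f zero) (λ j → sumF (λ i → f (suc i) j))))

  sumF-δ : ∀ {k} (x : Fin k) a → sumF (δ x a) ≈ a
  sumF-δ {suc k} zero    a = ≈-trans (+-cong ≈-refl (sumF-0 k)) (+-identityʳ a)
  sumF-δ {suc k} (suc x) a = ≈-trans (+-identityˡ _) (sumF-δ x a)

  sumF-δ* : ∀ {k} (x : Fin k) (f : Fin k → Carrier) → sumF (λ i → δ x 1# i * f i) ≈ f x
  sumF-δ* x f = ≈-trans (sumF-cong δ*f≈δf) (sumF-δ x (f x))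
    where
    δ*f≈δf : ∀ i → δ x 1# i * f i ≈ δ x (f x) i
    δ*f≈δf i with i ≟ x
    ... | yes refl = *-identityˡ _
    ... | no _     = zeroˡ _

  sumF-pick : ∀ {k} (x : Fin k) (f : Fin k → Carrier) → sumF f ≈ sumF (f [ x ≔ 0# ]) + f x
  sumF-pick x f = ≈-trans (sumF-cong ([≔0]-split f x)) (≈-trans (sumF-+ (f [ x ≔ 0# ]) (δ x (f x)))
                                                                (+-cong ≈-refl (sumF-δ x (f x))))

  ∣sumF∣≤sumF∣∣ : ∀ {k} (f : Fin k → Carrier) → ∣ sumF f ∣ ≤ sumF (λ i → ∣ f i ∣)
  ∣sumF∣≤sumF∣∣ {zero}  f = reflexive ∣0∣≈0
  ∣sumF∣≤sumF∣∣ {suc k} f = ≤-trans (∣x+y∣≤∣x∣+∣y∣ _ _) (+-monoˡ-≤ _ (∣sumF∣≤sumF∣∣ (λ i → f (suc i))))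

  ∣[≔0]∣ : ∀ {k} (f : Fin k → Carrier) x i → ∣ (f [ x ≔ 0# ]) i ∣ ≈ ((λ j → ∣ f j ∣) [ x ≔ 0# ]) i
  ∣[≔0]∣ f x i with i ≟ x
  ... | yes _ = ∣0∣≈0
  ... | no _  = ≈-refl

  ∣δ∣ : ∀ {k} (x : Fin k) a i → ∣ δ x a i ∣ ≈ δ x ∣ a ∣ i
  ∣δ∣ x a i with i ≟ x
  ... | yes _ = ≈-refl
  ... | no _  = ∣0∣≈0

  -- Since Δ v is minus the sum of the other entries, ∣ Δ v ∣ is at most their absolute sum.
  balanced-entry≤half-norm : ∀ {k} (Δ : Fin k → Carrier) {ε} → sumF Δ ≈ 0# →
                             sumF (λ i → ∣ Δ i ∣) ≤ ε + ε → ∀ v → ∣ Δ v ∣ ≤ ε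
  balanced-entry≤half-norm Δ {ε} ΣΔ≈0 norm≤2ε v = x+x≤y+y⇒x≤y (begin
    ∣ Δ v ∣ + ∣ Δ v ∣                     ≈⟨ +-cong ∣Δv∣≈∣rest∣ ≈-refl ⟩
    ∣ sumF (Δ [ v ≔ 0# ]) ∣ + ∣ Δ v ∣     ≤⟨ +-monoʳ-≤ _ (∣sumF∣≤sumF∣∣ (Δ [ v ≔ 0# ])) ⟩
    sumF (λ i → ∣ (Δ [ v ≔ 0# ]) i ∣) + ∣ Δ v ∣ ≈⟨ +-cong (sumF-cong (∣[≔0]∣ Δ v)) ≈-refl ⟩
    sumF (∣Δ∣ [ v ≔ 0# ]) + ∣Δ∣ v         ≈⟨ sumF-pick v ∣Δ∣ ⟨
    sumF ∣Δ∣                              ≤⟨ norm≤2ε ⟩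
    ε + ε                                 ∎)
    where
    open ≤-Reasoning
    ∣Δ∣ : _ → Carrier
    ∣Δ∣ i = ∣ Δ i ∣
    ∣Δv∣≈∣rest∣ : ∣ Δ v ∣ ≈ ∣ sumF (Δ [ v ≔ 0# ]) ∣
    ∣Δv∣≈∣rest∣ = ≈-trans (∣-∣-cong (x+y≈0⇒y≈-x (≈-trans (≈-sym (sumF-pick v Δ)) ΣΔ≈0))) (∣-x∣≈∣x∣ _)

  norm-shift≤norm : ∀ {k} (Δ : Fin k → Carrier) v p →
                    sumF (λ u → ∣ (Δ [ v ≔ 0# ]) u + δ p (Δ v) u ∣) ≤ sumF (λ u → ∣ Δ u ∣)
  norm-shift≤norm Δ v p = begin
    sumF (λ u → ∣ Δ′ u + δ p (Δ v) u ∣)              ≤⟨ sumF-mono-≤ (λ u → ∣x+y∣≤∣x∣+∣y∣ (Δ′ u) (δp u)) ⟩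
    sumF (λ u → ∣ Δ′ u ∣ + ∣ δ p (Δ v) u ∣)          ≈⟨ sumF-+ (λ u → ∣ Δ′ u ∣) (λ u → ∣ δp u ∣) ⟩
    sumF (λ u → ∣ Δ′ u ∣) + sumF (λ u → ∣ δ p (Δ v) u ∣)
      ≈⟨ +-cong (sumF-cong (∣[≔0]∣ Δ v)) (≈-trans (sumF-cong (∣δ∣ p (Δ v))) (sumF-δ p _)) ⟩
    sumF (∣Δ∣ [ v ≔ 0# ]) + ∣Δ∣ v                    ≈⟨ sumF-pick v ∣Δ∣ ⟨
    sumF ∣Δ∣                                         ∎
    where
    open ≤-Reasoning
    Δ′ δp ∣Δ∣ : _ → Carrier
    Δ′ = Δ [ v ≔ 0# ]
    δp = δ p (Δ v)
    ∣Δ∣ i = ∣ Δ i ∣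

  balanced-on-point≈0 : ∀ {k} {f : Fin k → Carrier} x → (∀ i → i ≢ x → f i ≈ 0#) → sumF f ≈ 0# →
                        ∀ i → f i ≈ 0#
  balanced-on-point≈0 {f = f} x f≈0 Σf≈0 i with i ≟ x
  ... | no i≢x  = f≈0 i i≢x
  ... | yes refl = begin
    f x                       ≈⟨ +-identityˡ _ ⟨
    0# + f x                  ≈⟨ +-cong (sumF-zero rest≈0) ≈-refl ⟨
    sumF (f [ x ≔ 0# ]) + f x ≈⟨ sumF-pick x f ⟨
    sumF f                    ≈⟨ Σf≈0 ⟩
    0#                        ∎
    where
    open ≈-Reasoning
    rest≈0 : ∀ j → (f [ x ≔ 0# ]) j ≈ 0#
    rest≈0 j with j ≟ x
    ... | yes _   = ≈-refl
    ... | no j≢x  = f≈0 j j≢x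

  ∣δ-δ∣≤∣∣ : ∀ {k} (x : Fin k) a i j → ∣ δ x a i - δ x a j ∣ ≤ ∣ a ∣
  ∣δ-δ∣≤∣∣ x a i j with i ≟ x | j ≟ x
  ... | yes _ | yes _ = ≤-respˡ-≈ (≈-sym (≈-trans (∣-∣-cong (-‿inverseʳ a)) ∣0∣≈0)) (0≤∣x∣ a)
  ... | yes _ | no _  = reflexive (∣-∣-cong (≈-trans (+-cong ≈-refl -0#≈0#) (+-identityʳ a)))
  ... | no _  | yes _ = reflexive (≈-trans (∣-∣-cong (+-identityˡ _)) (∣-x∣≈∣x∣ a))
  ... | no _  | no _  = ≤-respˡ-≈ (≈-sym (≈-trans (∣-∣-cong (-‿inverseʳ 0#)) ∣0∣≈0)) (0≤∣x∣ a)

  sumOver : ∀ {k} → (Fin k → Bool) → (Fin k → Carrier) → Carrier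
  sumOver S f = sumF (λ i → if S i then f i else 0#)

  sumOver-remove : ∀ {k} {S : Fin k → Bool} {x} (f : Fin k → Carrier) → S x ≡ true →
                   sumOver S f ≈ sumOver (remove x S) f + f x
  sumOver-remove {S = S} {x} f Sx =
    ≈-trans (sumF-pick x _) (+-cong (sumF-cong restrict) (≈-reflexive (≡.cong (λ b → if b then f x else 0#) Sx)))
    where
    restrict : ∀ i → ((λ j → if S j then f j else 0#) [ x ≔ 0# ]) i ≈ (if remove x S i then f i else 0#)
    restrict i with i ≟ x
    ... | yes _ = ≈-refl
    ... | no _  = ≈-refl

  sumOver-nonneg : ∀ {k} (S : Fin k → Bool) {f : Fin k → Carrier} → Nonneg f → 0# ≤ sumOver S f
  sumOver-nonneg S 0≤f = sumF-nonneg pointwise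
    where
    pointwise : ∀ i → 0# ≤ (if S i then _ else 0#)
    pointwise i with S i
    ... | true  = 0≤f i
    ... | false = ≤-refl

  sumOver+outside≤sumF : ∀ {k} {S : Fin k → Bool} {x} {f : Fin k → Carrier} → Nonneg f → S x ≡ false →
                         sumOver S f + f x ≤ sumF f
  sumOver+outside≤sumF {S = S} {x} {f} 0≤f Sx =
    ≤-respʳ-≈ (≈-sym (sumF-pick x f)) (+-monoʳ-≤ (f x) (sumF-mono-≤ pointwise))
    where
    pointwise : ∀ i → (if S i then f i else 0#) ≤ (f [ x ≔ 0# ]) i
    pointwise i with i ≟ x | S i in Si
    ... | yes refl | true with () ← ≡.trans (≡.sym Si) Sx
    ... | yes refl | false = ≤-refl
    ... | no _     | true  = ≤-refl
    ... | no _     | false = 0≤f i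

module Trees (G : Digraph) where

  open Digraph G
  open Counting

  Joins : Fin m → Fin n → Fin n → Set
  Joins a u w = (tail a ≡ u × head a ≡ w) ⊎ (head a ≡ u × tail a ≡ w)

  Touches : Fin m → Fin n → Set
  Touches a v = tail a ≡ v ⊎ head a ≡ v

  joins-sym : ∀ {a u w} → Joins a u w → Joins a w u
  joins-sym (inj₁ (t , h)) = inj₂ (h , t)
  joins-sym (inj₂ (h , t)) = inj₁ (t , h)

  joins-touches : ∀ {a u w} → Joins a u w → Touches a u
  joins-touches (inj₁ (t , _)) = inj₁ t
  joins-touches (inj₂ (h , _)) = inj₂ h

  joins-unique : ∀ {a v x y} → Joins a v x → Joins a v y → x ≡ y
  joins-unique (inj₁ (_ , h₁))  (inj₁ (_ , h₂))  = ≡.trans (≡.sym h₁) h₂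
  joins-unique (inj₁ (t₁ , h₁)) (inj₂ (h₂ , t₂)) = ≡.trans (≡.sym h₁) (≡.trans h₂ (≡.trans (≡.sym t₁) t₂))
  joins-unique (inj₂ (h₁ , t₁)) (inj₁ (t₂ , h₂)) = ≡.trans (≡.sym t₁) (≡.trans t₂ (≡.trans (≡.sym h₁) h₂))
  joins-unique (inj₂ (_ , t₁))  (inj₂ (_ , t₂))  = ≡.trans (≡.sym t₁) t₂

  joins-touches-other : ∀ {a u w v} → Joins a u w → Touches a v → u ≡ v ⊎ w ≡ v
  joins-touches-other (inj₁ (t , _)) (inj₁ tv) = inj₁ (≡.trans (≡.sym t) tv)
  joins-touches-other (inj₁ (_ , h)) (inj₂ hv) = inj₂ (≡.trans (≡.sym h) hv)
  joins-touches-other (inj₂ (_ , t)) (inj₁ tv) = inj₂ (≡.trans (≡.sym t) tv)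
  joins-touches-other (inj₂ (h , _)) (inj₂ hv) = inj₁ (≡.trans (≡.sym h) hv)

  data WalkIn (T : Fin m → Bool) : Fin n → Fin n → Set where
    []  : ∀ {u} → WalkIn T u u
    _∷_ : ∀ {a u w x} → T a ≡ true × Joins a u w → WalkIn T w x → WalkIn T u x

  IsTreeOn : (Fin n → Bool) → (Fin m → Bool) → Set
  IsTreeOn U T = (∀ a → T a ≡ true → U (tail a) ≡ true × U (head a) ≡ true)
               × (∀ u w → U u ≡ true → U w ≡ true → WalkIn T u w)
               × suc (count T) ≡ count U

  record Leaf (U : Fin n → Bool) (T : Fin m → Bool) : Set where
    field
      v p   : Fin n
      e     : Fin m
      Uv    : U v ≡ true
      Up    : U p ≡ true
      Te    : T e ≡ true
      joins : Joins e v p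
      p≢v   : p ≢ v
      only  : ∀ a → T a ≡ true → a ≢ e → tail a ≢ v × head a ≢ v

  module _ {U : Fin n → Bool} {T : Fin m → Bool} (L : Leaf U T) where
    open Leaf L

    touches-leaf⇒≡e : ∀ {a} → T a ≡ true → Touches a v → a ≡ e
    touches-leaf⇒≡e {a} Ta touches with a ≟ e | touches
    ... | yes a≡e | _         = a≡e
    ... | no a≢e  | inj₁ t≡v  = ⊥-elim (proj₁ (only a Ta a≢e) t≡v)
    ... | no a≢e  | inj₂ h≡v  = ⊥-elim (proj₂ (only a Ta a≢e) h≡v)

    joins-leaf⇒≡p : ∀ {a q} → T a ≡ true → Joins a v q → q ≡ p
    joins-leaf⇒≡p Ta a-vq with touches-leaf⇒≡e Ta (joins-touches a-vq)
    ... | refl = joins-unique a-vq joins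

    -- A walk through the leaf v must enter and leave along e, i.e. from p back to p.
    bypass-leaf : ∀ {u x} → u ≢ v → x ≢ v → WalkIn T u x → WalkIn (remove e T) u x
    bypass-leaf u≢v x≢v [] = []
    bypass-leaf {u} u≢v x≢v (_∷_ {a} {w = w} (Ta , a-uw) walk) with w ≟ v
    ... | no w≢v = (remove⁺ {P = T} a≢e Ta , a-uw) ∷ bypass-leaf w≢v x≢v walk
      where
      a≢e : a ≢ e
      a≢e refl with joins-touches-other a-uw (joins-touches joins)
      ... | inj₁ u≡v = u≢v u≡v
      ... | inj₂ w≡v = w≢v w≡v
    bypass-leaf u≢v x≢v (_ ∷ [])                        | yes refl = ⊥-elim (x≢v refl)
    bypass-leaf {u} u≢v x≢v ((Ta , a-uv) ∷ ((Tb , b-vw) ∷ walk)) | yes refl =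
      ≡.subst (λ y → WalkIn (remove e T) y _) (≡.sym u≡w) (bypass-leaf (λ w≡v → u≢v (≡.trans u≡w w≡v)) x≢v walk)
      where
      u≡w : u ≡ _
      u≡w = ≡.trans (joins-leaf⇒≡p Ta (joins-sym a-uv)) (≡.sym (joins-leaf⇒≡p Tb b-vw))

    remove-leaf : IsTreeOn U T → IsTreeOn (remove v U) (remove e T)
    remove-leaf (ends , connected , size) = ends′ , connected′ , size′
      where
      ends′ : ∀ a → remove e T a ≡ true → remove v U (tail a) ≡ true × remove v U (head a) ≡ true
      ends′ a a∈T′ =
        let a≢e , Ta    = remove⁻ {P = T} a∈T′
            t≢v , h≢v   = only a Ta a≢e
            Ut  , Uh    = ends a Ta
        in remove⁺ {P = U} t≢v Ut , remove⁺ {P = U} h≢v Uh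
      connected′ : ∀ u w → remove v U u ≡ true → remove v U w ≡ true → WalkIn (remove e T) u w
      connected′ u w u∈U′ w∈U′ =
        let u≢v , Uu = remove⁻ {P = U} u∈U′
            w≢v , Uw = remove⁻ {P = U} w∈U′
        in bypass-leaf u≢v w≢v (connected u w Uu Uw)
      size′ : suc (count (remove e T)) ≡ count (remove v U)
      size′ = ℕP.suc-injective (≡.trans (≡.cong suc (≡.sym (count-remove T Te)))
                                        (≡.trans size (count-remove U Uv)))

  arcsAt : (Fin m → Fin n) → (Fin m → Bool) → Fin n → Fin m → Bool
  arcsAt end T v a = T a ∧ does (v ≟ end a)

  degree : (Fin m → Bool) → Fin n → ℕ
  degree T v = count (arcsAt tail T v) ℕ.+ count (arcsAt head T v)

  arcsAt⁺ : ∀ end {T a v} → T a ≡ true → end a ≡ v → arcsAt end T v a ≡ true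
  arcsAt⁺ end {a = a} Ta refl with end a ≟ end a
  ... | yes _ = ≡.cong (_∧ true) Ta
  ... | no ≢  = ⊥-elim (≢ refl)

  sum-count-arcsAt : ∀ end T → sum (λ v → count (arcsAt end T v)) ≡ count T
  sum-count-arcsAt end T = ≡.trans (∑-comm (λ v a → iverson (arcsAt end T v a))) (sum-cong-≗ column)
    where
    column : ∀ a → sum (λ v → iverson (arcsAt end T v a)) ≡ iverson (T a)
    column a with T a
    ... | true  = sum-iverson-≟ (end a)
    ... | false = sum-replicate-zero n

  sum-degree : ∀ T → sum (degree T) ≡ count T ℕ.+ count T
  sum-degree T = ≡.trans (∑-distrib-+ (λ v → count (arcsAt tail T v)) (λ v → count (arcsAt head T v)))
                         (≡.cong₂ ℕ._+_ (sum-count-arcsAt tail T) (sum-count-arcsAt head T))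

  loop⇒2≤degree : ∀ {T a v} → T a ≡ true → tail a ≡ v → head a ≡ v → 2 ℕ.≤ degree T v
  loop⇒2≤degree {T} {v = v} Ta t≡v h≡v =
    ℕP.+-mono-≤ (1≤count (arcsAt tail T v) (arcsAt⁺ tail {T} Ta t≡v)) (1≤count (arcsAt head T v) (arcsAt⁺ head {T} Ta h≡v))

  two-arcs⇒2≤degree : ∀ {T a b v} → T a ≡ true → T b ≡ true → a ≢ b → Touches a v → Touches b v →
                      2 ℕ.≤ degree T v
  two-arcs⇒2≤degree {T} {v = v} Ta Tb a≢b (inj₁ ta) (inj₁ tb) =
    ℕP.≤-trans (2≤count (arcsAt tail T v) (arcsAt⁺ tail {T} Ta ta) (arcsAt⁺ tail {T} Tb tb) a≢b) (ℕP.m≤m+n _ _)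
  two-arcs⇒2≤degree {T} {v = v} Ta Tb a≢b (inj₂ ha) (inj₂ hb) =
    ℕP.≤-trans (2≤count (arcsAt head T v) (arcsAt⁺ head {T} Ta ha) (arcsAt⁺ head {T} Tb hb) a≢b) (ℕP.m≤n+m _ _)
  two-arcs⇒2≤degree {T} {v = v} Ta Tb _ (inj₁ ta) (inj₂ hb) =
    ℕP.+-mono-≤ (1≤count (arcsAt tail T v) (arcsAt⁺ tail {T} Ta ta)) (1≤count (arcsAt head T v) (arcsAt⁺ head {T} Tb hb))
  two-arcs⇒2≤degree {T} {v = v} Ta Tb _ (inj₂ ha) (inj₁ tb) =
    ℕP.+-mono-≤ (1≤count (arcsAt tail T v) (arcsAt⁺ tail {T} Tb tb)) (1≤count (arcsAt head T v) (arcsAt⁺ head {T} Ta ha))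

  leaf-at-arc : ∀ {U T v e p} → IsTreeOn U T → U v ≡ true → degree T v ℕ.< 2 →
                T e ≡ true → Joins e v p → Leaf U T
  leaf-at-arc {U} {T} {v} {e} {p} (ends , _ , _) Uv deg<2 Te joins = record
    { v = v ; p = p ; e = e ; Uv = Uv ; Up = Up joins ; Te = Te ; joins = joins
    ; p≢v = p≢v joins ; only = only }
    where
    Up : ∀ {q} → Joins e v q → U q ≡ true
    Up (inj₁ (_ , refl)) = proj₂ (ends e Te)
    Up (inj₂ (_ , refl)) = proj₁ (ends e Te)
    p≢v : ∀ {q} → Joins e v q → q ≢ v
    p≢v (inj₁ (t , h)) refl = ℕP.<⇒≱ deg<2 (loop⇒2≤degree Te t h)
    p≢v (inj₂ (h , t)) refl = ℕP.<⇒≱ deg<2 (loop⇒2≤degree Te t h)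
    only : ∀ a → T a ≡ true → a ≢ e → tail a ≢ v × head a ≢ v
    only a Ta a≢e = (λ t → ℕP.<⇒≱ deg<2 (two-arcs⇒2≤degree Ta Te a≢e (inj₁ t) (joins-touches joins)))
                  , (λ h → ℕP.<⇒≱ deg<2 (two-arcs⇒2≤degree Ta Te a≢e (inj₂ h) (joins-touches joins)))

  -- The degrees sum to 2 ∣T∣ = 2 ∣U∣ - 2, so some vertex of U has degree at most 1.
  leaf-exists : ∀ {k U T} → IsTreeOn U T → count U ≡ suc (suc k) → Leaf U T
  leaf-exists {k} {U} {T} tree@(_ , connected , size) count≡ with sum<sum⇒∃< (degree T) twiceU Σdegree<Σtwice
    where
    twiceU : Fin n → ℕ
    twiceU v = if U v then 2 else 0
    twice : ∀ v → twiceU v ≡ iverson (U v) ℕ.+ iverson (U v)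
    twice v with U v
    ... | true  = refl
    ... | false = refl
    Σdegree<Σtwice : sum (degree T) ℕ.< sum twiceU
    Σdegree<Σtwice rewrite sum-degree T
                         | sum-cong-≗ {x = twiceU} {y = λ v → iverson (U v) ℕ.+ iverson (U v)} (λ v → twice v)
                         | ∑-distrib-+ (λ v → iverson (U v)) (λ v → iverson (U v))
                         | ℕP.suc-injective (≡.trans size count≡) | count≡ =
      ℕP.+-mono-< (ℕP.n<1+n (suc k)) (ℕP.n<1+n (suc k))
  ... | v , deg<twice with U v in Uv
  ...   | true  = let w , w∈U′ = count≡suc⇒∃ (remove v U) (ℕP.suc-injective (≡.trans (≡.sym (count-remove U Uv)) count≡))
                      w≢v , Uw = remove⁻ {P = U} w∈U′
                  in from-walk Uv deg<twice w≢v (connected v w Uv Uw)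
    where
    from-walk : ∀ {v w} → U v ≡ true → degree T v ℕ.< 2 → w ≢ v → WalkIn T v w → Leaf U T
    from-walk _  _      w≢v []                 = ⊥-elim (w≢v refl)
    from-walk Uv deg<2 _   ((Te , joins) ∷ _) = leaf-at-arc tree Uv deg<2 Te joins
  ...   | false with () ← deg<twice

  data Peeling : (Fin n → Bool) → (Fin m → Bool) → Set where
    trivial : ∀ {U T} u₀ → (∀ u → U u ≡ true → u ≡ u₀) → (∀ a → T a ≡ false) → Peeling U T
    peel    : ∀ {U T} (L : Leaf U T) → Peeling (remove (Leaf.v L) U) (remove (Leaf.e L) T) → Peeling U T

  peeling : ∀ k {U T} → count U ≡ suc k → IsTreeOn U T → Peeling U T
  peeling zero {U} {T} count≡1 (_ , _ , size) with count≡1⇒singleton U count≡1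
  ... | u₀ , _ , U⊆u₀ = trivial u₀ U⊆u₀ (λ a → count≡0⇒false T (ℕP.suc-injective (≡.trans size count≡1)))
  peeling (suc k) {U} {T} count≡ tree =
    peel L (peeling k (ℕP.suc-injective (≡.trans (≡.sym (count-remove U (Leaf.Uv L))) count≡)) (remove-leaf L tree))
    where
    L : Leaf U T
    L = leaf-exists tree count≡

module Incidence {c ℓ₁ ℓ₂ : Level} (F : OrderedField c ℓ₁ ℓ₂) (G : Digraph) where

  open OrderedFieldProperties F
  open FiniteSums F
  open Digraph G
  open Trees G using (Joins; Leaf)
  open Counting using (remove; remove⁻)

  A : Fin n → Fin m → Carrier
  A = inc G F

  netflow : (Fin m → Carrier) → Fin n → Carrier
  netflow x v = sumF (λ a → A v a * x a)

  tension : (Fin n → Carrier) → Fin m → Carrier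
  tension y a = y (head a) - y (tail a)

  PotentialOn : (Fin m → Bool) → (Fin m → Carrier) → (Fin n → Carrier) → Set ℓ₁
  PotentialOn T c′ y = ∀ a → T a ≡ true → tension y a ≈ c′ a

  A-head : ∀ {v a} → head a ≡ v → tail a ≢ v → A v a ≈ 1#
  A-head h≡v t≢v = ≈-trans (+-cong (δ-≡ 1# (≡.sym h≡v)) (-‿cong (δ-≢ 1# (λ v≡t → t≢v (≡.sym v≡t)))))
                           (≈-trans (+-cong ≈-refl -0#≈0#) (+-identityʳ 1#))

  A-tail : ∀ {v a} → tail a ≡ v → head a ≢ v → A v a ≈ - 1#
  A-tail t≡v h≢v = ≈-trans (+-cong (δ-≢ 1# (λ v≡h → h≢v (≡.sym v≡h))) (-‿cong (δ-≡ 1# (≡.sym t≡v))))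
                           (+-identityˡ _)

  A-off : ∀ {v a} → head a ≢ v → tail a ≢ v → A v a ≈ 0#
  A-off h≢v t≢v = x≈0⇒y≈0⇒x-y≈0 (δ-≢ 1# (λ v≡h → h≢v (≡.sym v≡h))) (δ-≢ 1# (λ v≡t → t≢v (≡.sym v≡t)))

  A-integral : ∀ v a → Integral (A v a)
  A-integral v a = integral-- (δ-integral (head a)) (δ-integral (tail a))
    where
    δ-integral : ∀ x → Integral (δ x 1# v)
    δ-integral x with v ≟ x
    ... | yes _ = + 1 , ≈-sym (+-identityʳ 1#)
    ... | no _  = + 0 , ≈-refl

  sumF-A*≈tension : ∀ a (y : Fin n → Carrier) → sumF (λ v → A v a * y v) ≈ tension y a
  sumF-A*≈tension a y = begin
    sumF (λ v → A v a * y v)                                      ≈⟨ sumF-cong (λ v → [y-z]x≈yx-zx (y v) _ _) ⟩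
    sumF (λ v → δ (head a) 1# v * y v - δ (tail a) 1# v * y v)
      ≈⟨ sumF-- (λ v → δ (head a) 1# v * y v) (λ v → δ (tail a) 1# v * y v) ⟩
    sumF (λ v → δ (head a) 1# v * y v) - sumF (λ v → δ (tail a) 1# v * y v)
                                                                  ≈⟨ +-cong (sumF-δ* (head a) y) (-‿cong (sumF-δ* (tail a) y)) ⟩
    tension y a                                                   ∎
    where open ≈-Reasoning

  slack≈cost-tension : ∀ {a y r c′} → sumF (λ v → A v a * y v) + r ≈ c′ → r ≈ c′ - tension y a
  slack≈cost-tension {a} {y} {r} {c′} Aᵀy+r≈c′ = begin
    r                                              ≈⟨ solve 2 (λ t r → r := t :+ r :- t) ≈-refl (tension y a) r ⟩
    tension y a + r - tension y a                  ≈⟨ +-cong (+-cong (sumF-A*≈tension a y) ≈-refl) ≈-refl ⟨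
    sumF (λ v → A v a * y v) + r - tension y a     ≈⟨ +-cong Aᵀy+r≈c′ ≈-refl ⟩
    c′ - tension y a                               ∎
    where open ≈-Reasoning

  tight⇒tension≈cost : ∀ {a y r c′} → sumF (λ v → A v a * y v) + r ≈ c′ → r ≈ 0# → tension y a ≈ c′
  tight⇒tension≈cost {a} {y} {r} {c′} Aᵀy+r≈c′ r≈0 = begin
    tension y a                     ≈⟨ sumF-A*≈tension a y ⟨
    sumF (λ v → A v a * y v)        ≈⟨ +-identityʳ _ ⟨
    sumF (λ v → A v a * y v) + 0#   ≈⟨ +-cong ≈-refl r≈0 ⟨
    sumF (λ v → A v a * y v) + r    ≈⟨ Aᵀy+r≈c′ ⟩
    c′                              ∎
    where open ≈-Reasoning

  sumF-netflow : ∀ x → sumF (netflow x) ≈ 0#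
  sumF-netflow x = ≈-trans (sumF-swap (λ v a → A v a * x a))
                           (sumF-zero (λ a → ≈-trans (sumF-A*≈tension a (λ _ → x a)) (-‿inverseʳ (x a))))

  netflow-split : ∀ e w {z z′ : Fin m → Carrier} → (∀ a → z a ≈ z′ a + δ e w a) →
                  ∀ v → netflow z v ≈ netflow z′ v + A v e * w
  netflow-split e w {z} {z′} z≈z′+δ v = begin
    sumF (λ a → A v a * z a)                          ≈⟨ sumF-cong (λ a → ≈-trans (*-cong ≈-refl (z≈z′+δ a)) (distribˡ _ _ _)) ⟩
    sumF (λ a → A v a * z′ a + A v a * δ e w a)       ≈⟨ sumF-+ (λ a → A v a * z′ a) (λ a → A v a * δ e w a) ⟩
    netflow z′ v + sumF (λ a → A v a * δ e w a)       ≈⟨ +-cong ≈-refl (≈-trans (sumF-cong Aδ≈δA) (sumF-δ e _)) ⟩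
    netflow z′ v + A v e * w                          ∎
    where
    open ≈-Reasoning
    Aδ≈δA : ∀ a → A v a * δ e w a ≈ δ e (A v e * w) a
    Aδ≈δA a with a ≟ e
    ... | yes refl = ≈-refl
    ... | no _     = zeroʳ _

  module LeafIncidence {U T} (L : Leaf U T) where

    open Leaf L

    σ : Carrier
    σ = A v e

    σ-sign : IsSign σ
    σ-sign with joins
    ... | inj₁ (t , h) = inj₂ (A-tail t (λ h≡v → p≢v (≡.trans (≡.sym h) h≡v)))
    ... | inj₂ (h , t) = inj₁ (A-head h (λ t≡v → p≢v (≡.trans (≡.sym t) t≡v)))

    A-p : A p e ≈ - σ
    A-p with joins
    ... | inj₁ (t , h) = ≈-trans (A-head h (λ t≡p → p≢v (≡.trans (≡.sym t≡p) t)))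
                                 (≈-trans (≈-sym (-‿involutive 1#)) (-‿cong (≈-sym (A-tail t (λ h≡v → p≢v (≡.trans (≡.sym h) h≡v))))))
    ... | inj₂ (h , t) = ≈-trans (A-tail t (λ h≡p → p≢v (≡.trans (≡.sym h≡p) h)))
                                 (-‿cong (≈-sym (A-head h (λ t≡v → p≢v (≡.trans (≡.sym t) t≡v)))))

    A-other : ∀ {u} → u ≢ v → u ≢ p → A u e ≈ 0#
    A-other u≢v u≢p with joins
    ... | inj₁ (t , h) = A-off (λ h≡u → u≢p (≡.trans (≡.sym h≡u) h)) (λ t≡u → u≢v (≡.trans (≡.sym t≡u) t))
    ... | inj₂ (h , t) = A-off (λ h≡u → u≢v (≡.trans (≡.sym h≡u) h)) (λ t≡u → u≢p (≡.trans (≡.sym t≡u) t))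

    tension-e : ∀ y → tension y e ≈ σ * (y v - y p)
    tension-e y with joins
    ... | inj₁ (refl , refl) = begin
      y p - y v         ≈⟨ solve 2 (λ x y → y :- x := :- (x :- y)) ≈-refl (y v) (y p) ⟩
      - (y v - y p)     ≈⟨ -1*x≈-x _ ⟨
      - 1# * (y v - y p) ≈⟨ *-cong (A-tail refl p≢v) ≈-refl ⟨
      σ * (y v - y p)   ∎
      where open ≈-Reasoning
    ... | inj₂ (refl , refl) = ≈-trans (≈-sym (*-identityˡ _)) (*-cong (≈-sym (A-head refl p≢v)) ≈-refl)

    netflow-leaf : ∀ z → Supported (remove e T) z → netflow z v ≈ 0#
    netflow-leaf z z-supported = sumF-zero Az≈0
      where
      Az≈0 : ∀ a → A v a * z a ≈ 0#
      Az≈0 a with remove e T a in a∈T′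
      ... | false = ≈-trans (*-cong ≈-refl (z-supported a a∈T′)) (zeroʳ _)
      ... | true  = let a≢e , Ta = remove⁻ {P = T} a∈T′
                        t≢v , h≢v = only a Ta a≢e
                    in ≈-trans (*-cong (A-off h≢v t≢v) ≈-refl) (zeroˡ _)

module PrimalTransfer {c ℓ₁ ℓ₂ : Level} (F : OrderedField c ℓ₁ ℓ₂) (G : Digraph) (ε : OrderedField.Carrier F) where

  open OrderedFieldProperties F
  open FiniteSums F
  open Digraph G
  open Counting
  open Trees G
  open Incidence F G

  TreeFlow : (Fin m → Bool) → (Fin n → Carrier) → Set (c ⊔ ℓ₁ ⊔ ℓ₂)
  TreeFlow T β = ∃ λ x → Supported T x × (∀ u → netflow x u ≈ β u) × Nonneg x

  record ApproxFlow (U : Fin n → Bool) (T : Fin m → Bool) (β : Fin n → Carrier) (x̃ : Fin m → Carrier) :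
                    Set (ℓ₁ ⊔ ℓ₂) where
    field
      β-integral     : ∀ u → Integral (β u)
      β-supported    : Supported U β
      β-balanced     : sumF β ≈ 0#
      x̃-supported    : Supported T x̃
      x̃-nonneg       : Nonneg x̃
      residual-small : sumF (λ u → ∣ β u - netflow x̃ u ∣) ≤ ε + ε

  module LeafStep (ε<1 : ε < 1#) {U T β x̃} (L : Leaf U T) (approx : ApproxFlow U T β x̃) where

    open Leaf L
    open LeafIncidence L
    open ApproxFlow approx

    Δ : Fin n → Carrier
    Δ u = β u - netflow x̃ u

    -- Conservation at the leaf v determines the flow on its only tree arc e.
    forced : Carrier
    forced = σ * β v

    d : Carrier
    d = forced - x̃ e

    β′ : Fin n → Carrier
    β′ u = β u - A u e * forced

    x̃′ : Fin m → Carrier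
    x̃′ = x̃ [ e ≔ 0# ]

    x̃′-supported : Supported (remove e T) x̃′
    x̃′-supported a a∉T′ with a ≟ e
    ... | yes _   = ≈-refl
    ... | no _    = x̃-supported a a∉T′

    netflow-x̃ : ∀ u → netflow x̃ u ≈ netflow x̃′ u + A u e * x̃ e
    netflow-x̃ = netflow-split e (x̃ e) ([≔0]-split x̃ e)

    Δv≈σd : Δ v ≈ σ * d
    Δv≈σd = begin
      β v - netflow x̃ v                 ≈⟨ +-cong ≈-refl (-‿cong (netflow-x̃ v)) ⟩
      β v - (netflow x̃′ v + σ * x̃ e)    ≈⟨ +-cong ≈-refl (-‿cong (+-cong (netflow-leaf x̃′ x̃′-supported) ≈-refl)) ⟩
      β v - (0# + σ * x̃ e)              ≈⟨ +-cong ≈-refl (-‿cong (+-identityˡ _)) ⟩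
      β v - σ * x̃ e                     ≈⟨ +-cong (sign-flip σ-sign ≈-refl) ≈-refl ⟩
      σ * (σ * β v) - σ * x̃ e           ≈⟨ x[y-z]≈xy-xz σ _ _ ⟨
      σ * d                             ∎
      where open ≈-Reasoning

    ∣d∣≤ε : ∣ d ∣ ≤ ε
    ∣d∣≤ε = ≤-respˡ-≈ (≈-trans (∣-∣-cong Δv≈σd) (∣sign*x∣≈∣x∣ σ-sign d))
              (balanced-entry≤half-norm Δ ΣΔ≈0 residual-small v)
      where
      ΣΔ≈0 : sumF Δ ≈ 0#
      ΣΔ≈0 = ≈-trans (sumF-- β (netflow x̃)) (x≈0⇒y≈0⇒x-y≈0 β-balanced (sumF-netflow x̃))

    forced-integral : Integral forced
    forced-integral = integral-* (A-integral v e) (β-integral v)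

    forced-nonneg : 0# ≤ forced
    forced-nonneg = integral-near-nonneg forced-integral (x̃-nonneg e) ∣d∣≤ε ε<1

    residual′ : ∀ u → β′ u - netflow x̃′ u ≈ (Δ [ v ≔ 0# ]) u + δ p (Δ v) u
    residual′ u = ≈-trans shift (by-cases u)
      where
      shift : β′ u - netflow x̃′ u ≈ Δ u - A u e * d
      shift = ≈-trans (solve 5 (λ b f a w x → b :- a :* w :- f := b :- (f :+ a :* x) :- a :* (w :- x)) ≈-refl
                                 (β u) (netflow x̃′ u) (A u e) forced (x̃ e))
                      (+-cong (+-cong ≈-refl (-‿cong (≈-sym (netflow-x̃ u)))) ≈-refl)
      by-cases : ∀ u → Δ u - A u e * d ≈ (Δ [ v ≔ 0# ]) u + δ p (Δ v) u
      by-cases u with u ≟ v | u ≟ p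
      ... | yes refl | yes p≡v = ⊥-elim (p≢v (≡.sym p≡v))
      ... | yes refl | no _    = ≈-trans (+-cong Δv≈σd ≈-refl) (≈-trans (-‿inverseʳ _) (≈-sym (+-identityˡ 0#)))
      ... | no _     | yes refl = +-cong ≈-refl (≈-trans (-‿cong (*-cong A-p ≈-refl))
                                   (≈-trans (-‿cong (≈-sym (-‿distribˡ-* σ d))) (≈-trans (-‿involutive _) (≈-sym Δv≈σd))))
      ... | no u≢v   | no u≢p  = +-cong ≈-refl (x≈0⇒-x≈0 (≈-trans (*-cong (A-other u≢v u≢p) ≈-refl) (zeroˡ d)))

    reduced : ApproxFlow (remove v U) (remove e T) β′ x̃′
    reduced = record
      { β-integral     = λ u → integral-- (β-integral u) (integral-* (A-integral u e) forced-integral)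
      ; β-supported    = β′-supported
      ; β-balanced     = β′-balanced
      ; x̃-supported    = x̃′-supported
      ; x̃-nonneg       = x̃′-nonneg
      ; residual-small = ≤-trans (≤-respˡ-≈ (≈-sym (sumF-cong (λ u → ∣-∣-cong (residual′ u)))) (norm-shift≤norm Δ v p))
                                 residual-small
      }
      where
      β′-supported : Supported (remove v U) β′
      β′-supported u u∉U′ with u ≟ v
      ... | yes refl = ≈-trans (+-cong ≈-refl (-‿cong (≈-sym (sign-flip σ-sign ≈-refl)))) (-‿inverseʳ (β v))
      ... | no u≢v   = x≈0⇒y≈0⇒x-y≈0 (β-supported u u∉U′) (≈-trans (*-cong (A-other u≢v u≢p) ≈-refl) (zeroˡ _))
        where
        u≢p : u ≢ p
        u≢p refl with () ← ≡.trans (≡.sym Up) u∉U′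
      β′-balanced : sumF β′ ≈ 0#
      β′-balanced = ≈-trans (sumF-- β (λ u → A u e * forced))
                            (x≈0⇒y≈0⇒x-y≈0 β-balanced (≈-trans (sumF-A*≈tension e (λ _ → forced)) (-‿inverseʳ forced)))
      x̃′-nonneg : Nonneg x̃′
      x̃′-nonneg a with a ≟ e
      ... | yes _ = ≤-refl
      ... | no _  = x̃-nonneg a

    extend : TreeFlow (remove e T) β′ → TreeFlow T β
    extend (x′ , x′-supported , netflow-x′ , x′-nonneg) = x , x-supported , netflow-x , x-nonneg
      where
      x : Fin m → Carrier
      x = x′ [ e ≔ forced ]
      x-supported : Supported T x
      x-supported a a∉T with a ≟ e
      ... | yes refl with () ← ≡.trans (≡.sym Te) a∉T
      ... | no _     = x′-supported a (remove-false {P = T} a∉T)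
      netflow-x : ∀ u → netflow x u ≈ β u
      netflow-x u = begin
        netflow x u
          ≈⟨ netflow-split e forced ([≔]-split x′ e forced (x′-supported e (remove-removes e T))) u ⟩
        netflow x′ u + A u e * forced   ≈⟨ +-cong (netflow-x′ u) ≈-refl ⟩
        β u - A u e * forced + A u e * forced ≈⟨ solve 2 (λ b t → b :- t :+ t := b) ≈-refl (β u) (A u e * forced) ⟩
        β u                             ∎
        where open ≈-Reasoning
      x-nonneg : Nonneg x
      x-nonneg a with a ≟ e
      ... | yes _ = forced-nonneg
      ... | no _  = x′-nonneg a

  approx⇒treeFlow : ε < 1# → ∀ {U T β x̃} → Peeling U T → ApproxFlow U T β x̃ → TreeFlow T β
  approx⇒treeFlow _ {U} {β = β} (trivial u₀ U⊆u₀ _) approx =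
    (λ _ → 0#) , (λ _ _ → ≈-refl) , netflow0≈β , (λ _ → ≤-refl)
    where
    open ApproxFlow approx
    off-u₀ : ∀ u → u ≢ u₀ → β u ≈ 0#
    off-u₀ u u≢u₀ with U u in Uu
    ... | true  = ⊥-elim (u≢u₀ (U⊆u₀ u Uu))
    ... | false = β-supported u Uu
    netflow0≈β : ∀ u → netflow (λ _ → 0#) u ≈ β u
    netflow0≈β u = ≈-trans (sumF-zero (λ a → zeroʳ (A u a))) (≈-sym (balanced-on-point≈0 u₀ off-u₀ β-balanced u))
  approx⇒treeFlow ε<1 (peel L P) approx = extend (approx⇒treeFlow ε<1 P reduced)
    where open LeafStep ε<1 L approx

module DualTransfer {c ℓ₁ ℓ₂ : Level} (F : OrderedField c ℓ₁ ℓ₂) (G : Digraph)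
                    (γ c̃ : Fin (Digraph.m G) → OrderedField.Carrier F) where

  open OrderedFieldProperties F
  open FiniteSums F
  open Digraph G
  open Counting
  open Trees G
  open Incidence F G

  D : Fin m → Carrier
  D a = γ a - c̃ a

  treeError : (Fin m → Bool) → Carrier
  treeError T = sumOver T (λ a → ∣ D a ∣)

  NearPotential : (Fin n → Bool) → (Fin m → Bool) → (Fin n → Carrier) → Set (c ⊔ ℓ₁ ⊔ ℓ₂)
  NearPotential U T ỹ = ∃ λ y → (∀ u → Integral (y u)) × PotentialOn T γ y
    × (∀ u w → U u ≡ true → U w ≡ true → ∣ (y w - ỹ w) - (y u - ỹ u) ∣ ≤ treeError T)

  module LeafStep (γ-integral : ∀ a → Integral (γ a)) {U T ỹ} (L : Leaf U T) (ỹ-potential : PotentialOn T c̃ ỹ) where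

    open Leaf L
    open LeafIncidence L

    ỹ-potential′ : PotentialOn (remove e T) c̃ ỹ
    ỹ-potential′ a a∈T′ = ỹ-potential a (proj₂ (remove⁻ {P = T} a∈T′))

    ρ : Fin n → Fin n
    ρ u = if does (u ≟ v) then p else u

    ρ-inside : ∀ u → U u ≡ true → remove v U (ρ u) ≡ true
    ρ-inside u Uu with u ≟ v
    ... | yes _  = remove⁺ {P = U} p≢v Up
    ... | no u≢v = remove⁺ {P = U} u≢v Uu

    extend : NearPotential (remove v U) (remove e T) ỹ → NearPotential U T ỹ
    extend (y′ , y′-integral , y′-potential , y′-near) = y , y-integral , y-potential , y-near
      where
      y : Fin n → Carrier
      y = y′ [ v ≔ y′ p + σ * γ e ]
      y-integral : ∀ u → Integral (y u)
      y-integral u with u ≟ v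
      ... | yes _ = integral-+ (y′-integral p) (integral-* (A-integral v e) (γ-integral e))
      ... | no _  = y′-integral u
      y-potential : PotentialOn T γ y
      y-potential a Ta with a ≟ e
      ... | yes refl = begin
        tension y e                          ≈⟨ tension-e y ⟩
        σ * (y v - y p)
          ≈⟨ *-cong ≈-refl (+-cong (≈-reflexive ([≔]-updates y′ v _)) (-‿cong (≈-reflexive ([≔]-minimal y′ _ p≢v)))) ⟩
        σ * ((y′ p + σ * γ e) - y′ p)
          ≈⟨ *-cong ≈-refl (solve 2 (λ q r → q :+ r :- q := r) ≈-refl (y′ p) (σ * γ e)) ⟩
        σ * (σ * γ e)                        ≈⟨ sign-flip σ-sign ≈-refl ⟨
        γ e                                  ∎
        where open ≈-Reasoning
      ... | no a≢e =
        let t≢v , h≢v = only a Ta a≢e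
        in ≈-trans (+-cong (≈-reflexive ([≔]-minimal y′ _ h≢v)) (-‿cong (≈-reflexive ([≔]-minimal y′ _ t≢v))))
                   (y′-potential a (remove⁺ {P = T} a≢e Ta))
      z z′ : Fin n → Carrier
      z u = y u - ỹ u
      z′ u = y′ u - ỹ u
      z-lift : ∀ u → z u ≈ z′ (ρ u) + δ v (σ * D e) u
      z-lift u with u ≟ v
      ... | yes refl = begin
        (y′ p + σ * γ e) - ỹ v                      ≈⟨ +-cong ≈-refl (-‿cong ỹv) ⟩
        (y′ p + σ * γ e) - (ỹ p + σ * c̃ e)          ≈⟨ solve 5 (λ a s g b h → a :+ s :* g :- (b :+ s :* h) := a :- b :+ s :* (g :- h))
                                                               ≈-refl (y′ p) σ (γ e) (ỹ p) (c̃ e) ⟩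
        z′ p + σ * D e                              ∎
        where
        open ≈-Reasoning
        ỹv : ỹ v ≈ ỹ p + σ * c̃ e
        ỹv = ≈-trans (solve 2 (λ a b → b := a :+ (b :- a)) ≈-refl (ỹ p) (ỹ v))
                     (+-cong ≈-refl (sign-flip σ-sign (≈-trans (≈-sym (ỹ-potential e Te)) (tension-e ỹ))))
      ... | no _ = ≈-sym (+-identityʳ _)
      y-near : ∀ u w → U u ≡ true → U w ≡ true → ∣ z w - z u ∣ ≤ treeError T
      y-near u w Uu Uw = begin
        ∣ z w - z u ∣                                   ≈⟨ ∣-∣-cong (+-cong (z-lift w) (-‿cong (z-lift u))) ⟩
        ∣ (z′ (ρ w) + δv w) - (z′ (ρ u) + δv u) ∣       ≈⟨ ∣-∣-cong (solve 4 (λ a b c d → a :+ b :- (c :+ d) := a :- c :+ (b :- d))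
                                                                           ≈-refl (z′ (ρ w)) (δv w) (z′ (ρ u)) (δv u)) ⟩
        ∣ (z′ (ρ w) - z′ (ρ u)) + (δv w - δv u) ∣       ≤⟨ ∣x+y∣≤∣x∣+∣y∣ _ _ ⟩
        ∣ z′ (ρ w) - z′ (ρ u) ∣ + ∣ δv w - δv u ∣       ≤⟨ +-mono-≤ (y′-near (ρ u) (ρ w) (ρ-inside u Uu) (ρ-inside w Uw))
                                                                   (∣δ-δ∣≤∣∣ v _ w u) ⟩
        treeError (remove e T) + ∣ σ * D e ∣            ≈⟨ +-cong ≈-refl (∣sign*x∣≈∣x∣ σ-sign (D e)) ⟩
        treeError (remove e T) + ∣ D e ∣                ≈⟨ sumOver-remove (λ a → ∣ D a ∣) Te ⟨
        treeError T                                     ∎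
        where
        open ≤-Reasoning
        δv : Fin n → Carrier
        δv = δ v (σ * D e)

  reduced-cost-close : ∀ {T y ỹ} a → T a ≡ false →
                       ∣ (y (head a) - ỹ (head a)) - (y (tail a) - ỹ (tail a)) ∣ ≤ treeError T →
                       ∣ (γ a - tension y a) - (c̃ a - tension ỹ a) ∣ ≤ sumF (λ a → ∣ D a ∣)
  reduced-cost-close {T} {y} {ỹ} a Ta near = begin
    ∣ (γ a - tension y a) - (c̃ a - tension ỹ a) ∣   ≈⟨ ∣-∣-cong regroup ⟩
    ∣ D a + - (z (head a) - z (tail a)) ∣           ≤⟨ ∣x+y∣≤∣x∣+∣y∣ _ _ ⟩
    ∣ D a ∣ + ∣ - (z (head a) - z (tail a)) ∣       ≈⟨ +-comm _ _ ⟩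
    ∣ - (z (head a) - z (tail a)) ∣ + ∣ D a ∣       ≈⟨ +-cong (∣-x∣≈∣x∣ _) ≈-refl ⟩
    ∣ z (head a) - z (tail a) ∣ + ∣ D a ∣           ≤⟨ +-monoʳ-≤ _ near ⟩
    treeError T + ∣ D a ∣                           ≤⟨ sumOver+outside≤sumF (λ a → 0≤∣x∣ (D a)) Ta ⟩
    sumF (λ a → ∣ D a ∣)                            ∎
    where
    open ≤-Reasoning
    z : Fin n → Carrier
    z v = y v - ỹ v
    regroup : (γ a - tension y a) - (c̃ a - tension ỹ a) ≈ D a + - (z (head a) - z (tail a))
    regroup = solve 6 (λ g c yh yt th tt → g :- (yh :- yt) :- (c :- (th :- tt))
                                            := g :- c :+ :- ((yh :- th) :- (yt :- tt)))
                      ≈-refl (γ a) (c̃ a) (y (head a)) (y (tail a)) (ỹ (head a)) (ỹ (tail a))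

  nearPotential : (∀ a → Integral (γ a)) → ∀ {U T ỹ} → Peeling U T → PotentialOn T c̃ ỹ → NearPotential U T ỹ
  nearPotential _ {U} {T} {ỹ} (trivial u₀ U⊆u₀ T≡∅) _ = (λ _ → 0#) , (λ _ → fromℤ-integral (+ 0)) , potential , near
    where
    potential : PotentialOn T γ (λ _ → 0#)
    potential a Ta with () ← ≡.trans (≡.sym Ta) (T≡∅ a)
    near : ∀ u w → U u ≡ true → U w ≡ true → ∣ (0# - ỹ w) - (0# - ỹ u) ∣ ≤ treeError T
    near u w Uu Uw rewrite U⊆u₀ u Uu | U⊆u₀ w Uw =
      ≤-respˡ-≈ (≈-sym (≈-trans (∣-∣-cong (-‿inverseʳ _)) ∣0∣≈0)) (sumOver-nonneg T (λ a → 0≤∣x∣ (D a)))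
  nearPotential γ-integral {ỹ = ỹ} (peel L P) ỹ-potential = extend (nearPotential γ-integral P ỹ-potential′)
    where open LeafStep γ-integral {ỹ = ỹ} L ỹ-potential

module FeasibilityTransfer {c ℓ₁ ℓ₂ : Level} (F : OrderedField c ℓ₁ ℓ₂) (G : Digraph) where

  open OrderedFieldProperties F
  open FiniteSums F
  open Digraph G
  open Counting
  open Trees G
  open Incidence F G

  card≡count : ∀ {k} (S : Subset k) → card S ≡ count (lookup S)
  card≡count []          = refl
  card≡count (true ∷ S)  = ≡.cong suc (card≡count S)
  card≡count (false ∷ S) = card≡count S

  ∉⇒false : ∀ {k} (S : Subset k) {a} → a ∉ S → lookup S a ≡ false
  ∉⇒false S {a} a∉S with lookup S a in Sa
  ... | false = refl
  ... | true  = ⊥-elim (a∉S (lookup⇒[]= a S Sa))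

  false⇒∉ : ∀ {k} (S : Subset k) {a} → lookup S a ≡ false → a ∉ S
  false⇒∉ S Sa≡false a∈S with () ← ≡.trans (≡.sym ([]=⇒lookup a∈S)) Sa≡false

  walk⇒walkIn : ∀ {S u w} → Walk G S u w → WalkIn (lookup S) u w
  walk⇒walkIn stay          = []
  walk⇒walkIn (fwd a∈S walk) = ([]=⇒lookup a∈S , inj₁ (refl , refl)) ∷ walk⇒walkIn walk
  walk⇒walkIn (bwd a∈S walk) = ([]=⇒lookup a∈S , inj₂ (refl , refl)) ∷ walk⇒walkIn walk

  spanningTree⇒peeling : ∀ {T} → SpanningTree G T → Fin n → Peeling (λ _ → true) (lookup T)
  spanningTree⇒peeling {T} (spans , size) v₀ = peeling (n ∸ 1) count≡ tree
    where
    count≡ : count {n} (λ _ → true) ≡ suc (n ∸ 1)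
    count≡ = ≡.trans (count-all n) (suc-pred v₀)
      where
      suc-pred : ∀ {k} → Fin k → k ≡ suc (k ∸ 1)
      suc-pred zero    = refl
      suc-pred (suc _) = refl
    tree : IsTreeOn (λ _ → true) (lookup T)
    tree = (λ _ _ → refl , refl) , (λ u w _ _ → walk⇒walkIn (spans u w))
         , ≡.trans (≡.cong suc (≡.trans (≡.sym (card≡count T)) size)) (≡.sym count≡)

  vertex-or-empty : Fin n ⊎ ¬ Fin n
  vertex-or-empty with n
  ... | zero  = inj₂ (λ ())
  ... | suc _ = inj₁ zero

  primal-transfer : (b : Fin n → ℤ) → sumℤ b ≡ + 0 → ∀ {ε} → ε < 1# → (b̃ : Fin n → Carrier) →
                    dist₁ (λ v → fromℤ (b v)) b̃ ≤ ε + ε → ∀ {T} → SpanningTree G T →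
                    PrimalFeasible G F T b̃ → PrimalFeasible G F T (λ v → fromℤ (b v))
  primal-transfer b Σb≡0 {ε} ε<1 b̃ dist≤2ε {T} spanning (x̃ , (Ax̃≈b̃ , x̃-supported) , x̃-nonneg) with vertex-or-empty
  ... | inj₂ no-vertex = (λ _ → 0#) , ((λ v → ⊥-elim (no-vertex v)) , (λ _ _ → ≈-refl)) , (λ _ → ≤-refl)
  ... | inj₁ v₀ =
    let x , x-supported , Ax≈β , x-nonneg = approx⇒treeFlow ε<1 (spanningTree⇒peeling spanning v₀) approx
    in x , (Ax≈β , λ a a∉T → x-supported a (∉⇒false T a∉T)) , x-nonneg
    where
    open PrimalTransfer F G ε
    β : Fin n → Carrier
    β v = fromℤ (b v)
    approx : ApproxFlow (λ _ → true) (lookup T) β x̃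
    approx = record
      { β-integral     = λ v → fromℤ-integral (b v)
      ; β-supported    = λ _ ()
      ; β-balanced     = ≈-trans (sumF-fromℤ b) (≈-reflexive (≡.cong fromℤ Σb≡0))
      ; x̃-supported    = λ a a∉T → x̃-supported a (false⇒∉ T a∉T)
      ; x̃-nonneg       = x̃-nonneg
      ; residual-small = ≤-respˡ-≈ (sumF-cong (λ v → ∣-∣-cong (+-cong ≈-refl (-‿cong (≈-sym (Ax̃≈b̃ v)))))) dist≤2ε
      }

  dual-transfer : (cv : Fin m → ℤ) → ∀ {ε} → ε < 1# → (c̃ : Fin m → Carrier) →
                  dist₁ (λ a → fromℤ (cv a)) c̃ ≤ ε → ∀ {T} → SpanningTree G T →
                  DualFeasible G F T c̃ → DualFeasible G F T (λ a → fromℤ (cv a))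
  dual-transfer cv {ε} ε<1 c̃ dist≤ε {T} spanning (ỹ , s̃ , (Aᵀỹ+s̃≈c̃ , s̃-tree) , s̃-nonneg) with vertex-or-empty
  ... | inj₂ no-vertex =
    (λ _ → 0#) , (λ _ → 0#) , ((λ a → ⊥-elim (no-vertex (tail a))) , (λ _ _ → ≈-refl)) , (λ _ → ≤-refl)
  ... | inj₁ v₀ = y , s , (Aᵀy+s≈γ , λ a a∈T → s-tree a ([]=⇒lookup a∈T)) , s-nonneg
    where
    γ : Fin m → Carrier
    γ a = fromℤ (cv a)
    open DualTransfer F G γ c̃
    ỹ-potential : PotentialOn (lookup T) c̃ ỹ
    ỹ-potential a Ta = tight⇒tension≈cost (Aᵀỹ+s̃≈c̃ a) (s̃-tree a (lookup⇒[]= a T Ta))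
    near : NearPotential (λ _ → true) (lookup T) ỹ
    near = nearPotential (λ a → fromℤ-integral (cv a)) (spanningTree⇒peeling spanning v₀) ỹ-potential
    y : Fin n → Carrier
    y = proj₁ near
    y-integral : ∀ v → Integral (y v)
    y-integral = proj₁ (proj₂ near)
    y-potential : PotentialOn (lookup T) γ y
    y-potential = proj₁ (proj₂ (proj₂ near))
    y-near : ∀ u w → true ≡ true → true ≡ true → ∣ (y w - ỹ w) - (y u - ỹ u) ∣ ≤ treeError (lookup T)
    y-near = proj₂ (proj₂ (proj₂ near))
    s : Fin m → Carrier
    s a = γ a - tension y a
    Aᵀy+s≈γ : ∀ a → sumF (λ v → A v a * y v) + s a ≈ γ a
    Aᵀy+s≈γ a = ≈-trans (+-cong (sumF-A*≈tension a y) ≈-refl)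
                        (solve 2 (λ t g → t :+ (g :- t) := g) ≈-refl (tension y a) (γ a))
    s-tree : ∀ a → lookup T a ≡ true → s a ≈ 0#
    s-tree a Ta = ≈-trans (+-cong ≈-refl (-‿cong (y-potential a Ta))) (-‿inverseʳ (γ a))
    s-close : ∀ a → lookup T a ≡ false → ∣ s a - s̃ a ∣ ≤ ε
    s-close a Ta = ≤-trans (≤-respˡ-≈ (∣-∣-cong (+-cong ≈-refl (-‿cong (≈-sym s̃≈))))
                                      (reduced-cost-close {y = y} {ỹ} a Ta (y-near (tail a) (head a) refl refl)))
                           dist≤ε
      where
      s̃≈ : s̃ a ≈ c̃ a - tension ỹ a
      s̃≈ = slack≈cost-tension (Aᵀỹ+s̃≈c̃ a)
    s-nonneg : ∀ a → 0# ≤ s a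
    s-nonneg a with lookup T a in Ta
    ... | true  = reflexive (≈-sym (s-tree a Ta))
    ... | false = integral-near-nonneg (integral-- (fromℤ-integral (cv a)) (integral-- (y-integral _) (y-integral _)))
                                       (s̃-nonneg a) (s-close a Ta) ε<1

theorem9 : ∀ {c ℓ₁ ℓ₂ : Level} (F : OrderedField c ℓ₁ ℓ₂) (G : Digraph) →
    let open OrderedField F
        open Digraph G
    in Connected G →
       (b : Fin n → ℤ) → sumℤ b ≡ + 0 → (cv : Fin m → ℤ) →
       (ε : Carrier) → 0# < ε → ε < 1# →
       (b̃ : Fin n → Carrier) (c̃ : Fin m → Carrier) →
       dist₁ (λ v → fromℤ (b v)) b̃ ≤ ε + ε →
       dist₁ (λ a → fromℤ (cv a)) c̃ ≤ ε →
       (T : Subset m) → SpanningTree G T →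
       (PrimalFeasible G F T b̃ → PrimalFeasible G F T (λ v → fromℤ (b v)))
       × (DualFeasible G F T c̃ → DualFeasible G F T (λ a → fromℤ (cv a)))
       × (Optimal G F T b̃ c̃ → Optimal G F T (λ v → fromℤ (b v)) (λ a → fromℤ (cv a)))
theorem9 F G _ b Σb≡0 cv _ _ ε<1 b̃ c̃ dist-b dist-c T spanning =
  primal , dual , λ (primal-feasible , dual-feasible) → primal primal-feasible , dual dual-feasible
  where
  open OrderedField F using (fromℤ)
  open FeasibilityTransfer F G
  primal : PrimalFeasible G F T b̃ → PrimalFeasible G F T (λ v → fromℤ (b v))
  primal = primal-transfer b Σb≡0 ε<1 b̃ dist-b spanning
  dual : DualFeasible G F T c̃ → DualFeasible G F T (λ a → fromℤ (cv a))
  dual = dual-transfer cv ε<1 c̃ dist-c spanning
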